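{- For all positive integers $r,s,k$ with $1\le r,s\le k$, $$\sum_{n\ge0}\mathrm{GF}\big(\mathcal A_{2n+1}^{(k)}(r\to s);w_{AV}\big)\,x^{2n}=\begin{cases}(-1)^{r+s+1}V_rV_s\dfrac{x\,Q_{2r-2}(x)\,T_{AV}^{s-1}R_{AV}^{(k-s+1)}Q_{2k+1-2s}(x)}{Q_{2k}(x)},&r<s,\\[2mm] V_r-V_r^2\dfrac{x\,Q_{2r-2}(x)\,T_{AV}^{r-1}R_{AV}^{(k-r+1)}Q_{2k+1-2r}(x)}{Q_{2k}(x)},&r=s,\\[2mm] (-1)^{r+s+1}V_rV_s\dfrac{x\,Q_{2s-2}(x)\,T_{AV}^{r-1}R_{AV}^{(k-r+1)}Q_{2k+1-2r}(x)}{Q_{2k}(x)},&r>s,\end{cases}$$ and $$\sum_{n\ge0}\mathrm{GF}\big(\mathcal A_{2n+2}^{(k)}(r\to s);w_{AV}\big)\,x^{2n+1}=\begin{cases}(-1)^{r+s+1}V_rA_s\dfrac{x\,Q_{2r-2}(x)\,T_{AV}^{s}Q_{2k-2s}(x)}{Q_{2k}(x)},&r\le s,\\[2mm] (-1)^{r+s+1}V_rA_s\dfrac{x\,Q_{2s-1}(x)\,T_{AV}^{r-1}R_{AV}^{(k-r+1)}Q_{2k+1-2r}(x)}{Q_{2k}(x)},&r>s.\end{cases}$$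
   Context: $A_1,A_2,\dots,V_1,V_2,\dots$ are indeterminates. For positive integers $n,k$ and $1\le r,s\le k$, $\mathcal A_n^{(k)}(r\to s)$ is the set of integer sequences $(a_1,\dots,a_n)$ with $1\le a_i\le k$, $a_1=r$, $a_n=s$ and $a_1\le a_2\ge a_3\le a_4\ge\cdots$ (alternating). The weight of such a sequence is $w_{AV}(a_1,\dots,a_n)=\prod_{i=1}^{\lfloor n/2\rfloor}A_{a_{2i}}\prod_{i=1}^{\lceil n/2\rceil}V_{a_{2i-1}}$, and $\mathrm{GF}(\mathcal S;w)=\sum_{t\in\mathcal S}w(t)$. The polynomials $Q_n(x)$ are defined by $Q_0(x)=1$, $Q_1(x)=V_1x$ and, for $n\ge1$, $Q_{n+1}(x)=V_{(n+2)/2}\,x\,Q_n(x)-Q_{n-1}(x)$ if $n$ is even, $Q_{n+1}(x)=A_{(n+1)/2}\,x\,Q_n(x)-Q_{n-1}(x)$ if $n$ is odd. The operator $T_{AV}$ replaces every $A_i$ by $A_{i+1}$ and every $V_i$ by $V_{i+1}$; the operator $R_{AV}^{(j)}$ replaces every $A_i$ by $V_{j+1-i}$ and every $V_i$ by $A_{j+1-i}$ (operators act on the polynomial to their right, leaving $x$ fixed). -}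

module Defs where

open import Level using (Level)
open import Algebra.Bundles using (CommutativeRing)
open import Data.Nat using (ℕ; zero; suc; _∸_; _≤ᵇ_; _≡ᵇ_)
open import Data.Bool using (Bool; true; false; _∧_; if_then_else_)
open import Data.List using (List; []; _∷_; map; concatMap; upTo; foldr)
open import Data.Product using (_×_; _,_; proj₁; proj₂)

allSeqs : ℕ → ℕ → List (List ℕ)
allSeqs k zero    = [] ∷ []
allSeqs k (suc n) = concatMap (λ a → map (a ∷_) (allSeqs k n)) (map suc (upTo k))

altUp altDown : List ℕ → Bool
altUp []               = true
altUp (x ∷ [])         = true
altUp (x ∷ y ∷ rest)   = (x ≤ᵇ y) ∧ altDown (y ∷ rest)
altDown []             = true
altDown (x ∷ [])       = true
altDown (x ∷ y ∷ rest) = (y ≤ᵇ x) ∧ altUp (y ∷ rest)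

firstIs : ℕ → List ℕ → Bool
firstIs r []      = false
firstIs r (x ∷ _) = x ≡ᵇ r

lastIs : ℕ → List ℕ → Bool
lastIs s []           = false
lastIs s (x ∷ [])     = x ≡ᵇ s
lastIs s (_ ∷ y ∷ ys) = lastIs s (y ∷ ys)

inA : ℕ → ℕ → List ℕ → Bool
inA r s l = altUp l ∧ firstIs r l ∧ lastIs s l

isEven : ℕ → Bool
isEven zero          = true
isEven (suc zero)    = false
isEven (suc (suc n)) = isEven n

-- Everything over an arbitrary commutative ring R, the indeterminates
-- A_i, V_i being given by an assignment (A , V) : (ℕ → R) × (ℕ → R)
-- (index 0 unused).

module WithRing {c ℓ : Level} (R : CommutativeRing c ℓ) where
  open CommutativeRing R hiding (zero)

  Assign : Set c
  Assign = (ℕ → Carrier) × (ℕ → Carrier)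

  -- weight w_{AV}: odd positions get V, even positions get A
  wOdd wEven : Assign → List ℕ → Carrier
  wOdd  σ []       = 1#
  wOdd  σ (x ∷ xs) = proj₂ σ x * wEven σ xs
  wEven σ []       = 1#
  wEven σ (x ∷ xs) = proj₁ σ x * wOdd σ xs

  GF : Assign → ℕ → ℕ → ℕ → ℕ → Carrier
  GF σ k n r s =
    foldr (λ l acc → (if inA r s l then wOdd σ l else 0#) + acc) 0#
          (allSeqs k n)

  Series : Set c
  Series = ℕ → Carrier

  sumTo : (ℕ → Carrier) → ℕ → Carrier
  sumTo f zero    = f zero
  sumTo f (suc m) = sumTo f m + f (suc m)

  _⊛_ : Series → Series → Series
  (f ⊛ g) m = sumTo (λ i → f i * g (m ∸ i)) m

  mulX : Series → Series
  mulX f zero    = 0#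
  mulX f (suc m) = f m

  scale : Carrier → Series → Series
  scale c f m = c * f m

  _⊖_ : Series → Series → Series
  (f ⊖ g) m = f m - g m

  xS : Series
  xS (suc zero) = 1#
  xS _          = 0#

  oneS : Series
  oneS zero    = 1#
  oneS (suc _) = 0#

  -- coefficient in Q_{m+1} = coef m · x · Q_m − Q_{m−1}:
  -- V_{(m+2)/2} for m even, A_{(m+1)/2} for m odd
  coef : Assign → ℕ → Carrier
  coef σ zero          = proj₂ σ 1
  coef σ (suc zero)    = proj₁ σ 1
  coef σ (suc (suc m)) = coef ((λ i → proj₁ σ (suc i)) , (λ i → proj₂ σ (suc i))) m

  Q : Assign → ℕ → Series
  Q σ zero          = oneS
  Q σ (suc zero)    = scale (proj₂ σ 1) xS
  Q σ (suc (suc n)) = scale (coef σ (suc n)) (mulX (Q σ (suc n))) ⊖ Q σ n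

  -- "polynomials" in the indeterminates = functions of the assignment
  PolyAV : Set c
  PolyAV = Assign → Series

  T : PolyAV → PolyAV
  T P (a , v) = P ((λ i → a (suc i)) , (λ i → v (suc i)))

  Tpow : ℕ → PolyAV → PolyAV
  Tpow zero    P = P
  Tpow (suc t) P = T (Tpow t P)

  Rop : ℕ → PolyAV → PolyAV
  Rop j P (a , v) = P ((λ i → v (suc j ∸ i)) , (λ i → a (suc j ∸ i)))

  QP : ℕ → PolyAV
  QP n σ = Q σ n

  signPow : ℕ → Carrier
  signPow n = if isEven n then 1# else - 1#

  oddLenSeries : Assign → ℕ → ℕ → ℕ → Series
  oddLenSeries σ k r s m = if isEven m then GF σ k (suc m) r s else 0#

  evenLenSeries : Assign → ℕ → ℕ → ℕ → Series
  evenLenSeries σ k r s m = if isEven m then 0# else GF σ k (suc m) r s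

  -- aliases (so the statement can use ℕ-arithmetic unqualified)
  Car : Set c
  Car = Carrier

  infixl 7 _·_
  _·_ : Carrier → Carrier → Carrier
  _·_ = _*_

  infix 4 _≈R_
  _≈R_ : Carrier → Carrier → Set ℓ
  _≈R_ = _≈_

module Submission where

-- Put γ = coef (A , V), so that γ (2 j) = V_{j+1}, γ (2 j + 1) = A_{j+1}, and Q σ n is the
-- continuant of γ₀ x, …, γ_{n−1} x, the determinant of an n × n tridiagonal matrix. An alternating
-- sequence is a walk on the positions V₁, A₁, …, V_k, A_k, so the generating functions of the walks
-- into a fixed target solve a linear system in 2k unknowns; taking differences of consecutive
-- equations makes it tridiagonal with determinant Q_{2k}. By Cramer's rule the relevant column of the
-- adjugate is a product of a leading continuant, x Q_{2r−2} or x Q_{2s−1}, and a trailing one, which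
-- the operators T and R turn into the shifted and reflected Q's of the statement. The identities are
-- checked after multiplying by Q_{2k}, coefficient by coefficient, by induction on the length.

open import Defs
open import Level using (Level)
open import Algebra.Bundles using (CommutativeRing)
open import Data.Maybe using (Maybe; just; nothing)
open import Data.Nat as ℕ
  using (ℕ; zero; suc; _+_; _*_; _∸_; _≤_; _<_; _>_; z≤n; s≤s; _≤ᵇ_; _≡ᵇ_; ⌊_/2⌋)
import Data.Nat.Properties as ℕ
open import Data.Integer as ℤ using (ℤ; +_; -[1+_])
import Data.Integer.Properties as ℤ
import Data.Sign as Sign
open import Data.Bool using (Bool; true; false; if_then_else_; not; _∧_)
open import Data.Product using (_×_; _,_; proj₁; proj₂)
open import Data.List using (List; []; _∷_; map; concatMap; applyUpTo; foldr; _++_)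
open import Function.Base using (id)
open import Data.Nat.Tactic.RingSolver using (solve-∀)
open import Data.Sum using (inj₁; inj₂)
open import Relation.Binary.Definitions using (tri<; tri≈; tri>)
open import Relation.Binary.Bundles using (Setoid)
open import Relation.Binary.PropositionalEquality as ≡ using (_≡_; _≢_)
open import Relation.Nullary using (yes; no)
open import Data.Empty using (⊥-elim)
open import Data.Bool.Properties using (T-≡; ¬-not)
open import Function.Bundles using (Equivalence)
open import Algebra.Solver.Ring.AlmostCommutativeRing
  using (fromCommutativeRing; _-Raw-AlmostCommutative⟶_)
import Algebra.Solver.Ring as RingSolver
import Relation.Binary.Reasoning.Setoid as SetoidReasoning

≡ᵇ-true : ∀ {m n} → m ≡ n → (m ≡ᵇ n) ≡ true
≡ᵇ-true {m} {n} m≡n = Equivalence.to T-≡ (ℕ.≡⇒≡ᵇ m n m≡n)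

≡ᵇ-false : ∀ {m n} → m ≢ n → (m ≡ᵇ n) ≡ false
≡ᵇ-false {m} {n} m≢n = ¬-not λ eq → m≢n (ℕ.≡ᵇ⇒≡ m n (Equivalence.from T-≡ eq))

≤ᵇ-true : ∀ {m n} → m ≤ n → (m ≤ᵇ n) ≡ true
≤ᵇ-true m≤n = Equivalence.to T-≡ (ℕ.≤⇒≤ᵇ m≤n)

≤ᵇ-false : ∀ {m n} → n < m → (m ≤ᵇ n) ≡ false
≤ᵇ-false {m} {n} n<m = ¬-not λ eq → ℕ.<⇒≱ n<m (ℕ.≤ᵇ⇒≤ m n (Equivalence.from T-≡ eq))

⌊2n/2⌋≡n : ∀ n → ⌊ 2 * n /2⌋ ≡ n
⌊2n/2⌋≡n zero    = ≡.refl
⌊2n/2⌋≡n (suc n) rewrite ℕ.*-suc 2 n = ≡.cong suc (⌊2n/2⌋≡n n)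

⌊1+2n/2⌋≡n : ∀ n → ⌊ suc (2 * n) /2⌋ ≡ n
⌊1+2n/2⌋≡n zero    = ≡.refl
⌊1+2n/2⌋≡n (suc n) = ≡.trans (≡.cong (λ z → ⌊ suc z /2⌋) (ℕ.*-suc 2 n)) (≡.cong suc (⌊1+2n/2⌋≡n n))

≡ᵇ-double : ∀ a b → (2 * a ≡ᵇ 2 * b) ≡ (a ≡ᵇ b)
≡ᵇ-double a b with a ℕ.≟ b
... | yes a≡b = ≡.trans (≡ᵇ-true (≡.cong (2 *_) a≡b)) (≡.sym (≡ᵇ-true a≡b))
... | no a≢b  = ≡.trans (≡ᵇ-false (λ eq → a≢b (ℕ.*-cancelˡ-≡ a b 2 eq))) (≡.sym (≡ᵇ-false a≢b))

isEven-suc : ∀ m → isEven (suc m) ≡ not (isEven m)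
isEven-suc zero          = ≡.refl
isEven-suc (suc zero)    = ≡.refl
isEven-suc (suc (suc m)) = isEven-suc m

-- The standard library's ring solver needs coefficients with decidable equality; over an
-- arbitrary commutative ring we take them in ℤ.
module IntegerCoefficientSolver {c ℓ : Level} (R : CommutativeRing c ℓ) where
  open CommutativeRing R hiding (_+_; _*_)
  open CommutativeRing R using () renaming (_+_ to _+ᵣ_; _*_ to _*ᵣ_)
  open import Algebra.Properties.Semiring.Mult semiring using (×1-homo-*)
  open import Algebra.Properties.Monoid.Mult +-monoid using (×-homo-+) renaming (_×_ to _⨰_)
  open import Algebra.Properties.Ring ring
    using (-‿involutive; -‿distribˡ-*; -‿distribʳ-*; -0#≈0#; -‿+-comm)
  open SetoidReasoning setoid

  fromℤ : ℤ → Carrier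
  fromℤ (+ n)    = n ⨰ 1#
  fromℤ -[1+ n ] = - (suc n ⨰ 1#)

  fromℤ-neg : ∀ x → fromℤ (ℤ.- x) ≈ - fromℤ x
  fromℤ-neg (+ zero)  = sym -0#≈0#
  fromℤ-neg (+ suc n) = refl
  fromℤ-neg -[1+ n ]  = sym (-‿involutive _)

  fromℤ-⊖ : ∀ m n → fromℤ (m ℤ.⊖ n) ≈ m ⨰ 1# - n ⨰ 1#
  fromℤ-⊖ zero n = begin
    fromℤ (0 ℤ.⊖ n)     ≡⟨ ≡.cong fromℤ (ℤ.⊖-≤ {0} {n} ℕ.z≤n) ⟩
    fromℤ (ℤ.- (+ n))   ≈⟨ fromℤ-neg (+ n) ⟩
    - (n ⨰ 1#)          ≈⟨ +-identityˡ _ ⟨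
    0# - n ⨰ 1#         ∎
  fromℤ-⊖ (suc m) zero = begin
    suc m ⨰ 1#          ≈⟨ +-identityʳ _ ⟨
    suc m ⨰ 1# +ᵣ 0#    ≈⟨ +-congˡ -0#≈0# ⟨
    suc m ⨰ 1# - 0#     ∎
  fromℤ-⊖ (suc m) (suc n) = begin
    fromℤ (suc m ℤ.⊖ suc n)            ≡⟨ ≡.cong fromℤ (ℤ.[1+m]⊖[1+n]≡m⊖n m n) ⟩
    fromℤ (m ℤ.⊖ n)                    ≈⟨ fromℤ-⊖ m n ⟩
    m ⨰ 1# - n ⨰ 1#                    ≈⟨ +-identityˡ _ ⟨
    0# +ᵣ (m ⨰ 1# - n ⨰ 1#)            ≈⟨ +-congʳ (-‿inverseʳ 1#) ⟨
    (1# - 1#) +ᵣ (m ⨰ 1# - n ⨰ 1#)     ≈⟨ +-assoc _ _ _ ⟩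
    1# +ᵣ (- 1# +ᵣ (m ⨰ 1# - n ⨰ 1#))  ≈⟨ +-congˡ (+-assoc _ _ _) ⟨
    1# +ᵣ ((- 1# +ᵣ m ⨰ 1#) - n ⨰ 1#)  ≈⟨ +-congˡ (+-congʳ (+-comm _ _)) ⟩
    1# +ᵣ ((m ⨰ 1# - 1#) - n ⨰ 1#)     ≈⟨ +-congˡ (+-assoc _ _ _) ⟩
    1# +ᵣ (m ⨰ 1# +ᵣ (- 1# - n ⨰ 1#))  ≈⟨ +-congˡ (+-congˡ (-‿+-comm _ _)) ⟩
    1# +ᵣ (m ⨰ 1# - (1# +ᵣ n ⨰ 1#))    ≈⟨ +-assoc _ _ _ ⟨
    (1# +ᵣ m ⨰ 1#) - (1# +ᵣ n ⨰ 1#)    ∎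

  fromℤ-+ : ∀ x y → fromℤ (x ℤ.+ y) ≈ fromℤ x +ᵣ fromℤ y
  fromℤ-+ (+ m)    (+ n)    = ×-homo-+ 1# m n
  fromℤ-+ (+ m)    -[1+ n ] = fromℤ-⊖ m (suc n)
  fromℤ-+ -[1+ m ] (+ n)    = trans (fromℤ-⊖ n (suc m)) (+-comm _ _)
  fromℤ-+ -[1+ m ] -[1+ n ] = begin
    - (suc (suc (m ℕ.+ n)) ⨰ 1#)   ≡⟨ ≡.cong (λ z → - (suc z ⨰ 1#)) (ℕ.+-suc m n) ⟨
    - ((suc m ℕ.+ suc n) ⨰ 1#)     ≈⟨ -‿cong (×-homo-+ 1# (suc m) (suc n)) ⟩
    - (suc m ⨰ 1# +ᵣ suc n ⨰ 1#)   ≈⟨ -‿+-comm _ _ ⟨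
    - (suc m ⨰ 1#) - (suc n ⨰ 1#)  ∎

  fromℤ-◃⁺ : ∀ n → fromℤ (Sign.+ ℤ.◃ n) ≈ n ⨰ 1#
  fromℤ-◃⁺ zero    = refl
  fromℤ-◃⁺ (suc n) = refl

  fromℤ-◃⁻ : ∀ n → fromℤ (Sign.- ℤ.◃ n) ≈ - (n ⨰ 1#)
  fromℤ-◃⁻ zero    = sym -0#≈0#
  fromℤ-◃⁻ (suc n) = refl

  fromℤ-* : ∀ x y → fromℤ (x ℤ.* y) ≈ fromℤ x *ᵣ fromℤ y
  fromℤ-* (+ m) (+ n) = trans (fromℤ-◃⁺ (m ℕ.* n)) (×1-homo-* m n)
  fromℤ-* (+ m) -[1+ n ] =
    trans (fromℤ-◃⁻ (m ℕ.* suc n)) (trans (-‿cong (×1-homo-* m (suc n))) (-‿distribʳ-* _ _))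
  fromℤ-* -[1+ m ] (+ n) =
    trans (fromℤ-◃⁻ (suc m ℕ.* n)) (trans (-‿cong (×1-homo-* (suc m) n)) (-‿distribˡ-* _ _))
  fromℤ-* -[1+ m ] -[1+ n ] = begin
    fromℤ (Sign.+ ℤ.◃ (suc m ℕ.* suc n))   ≈⟨ fromℤ-◃⁺ (suc m ℕ.* suc n) ⟩
    (suc m ℕ.* suc n) ⨰ 1#                 ≈⟨ ×1-homo-* (suc m) (suc n) ⟩
    a *ᵣ b                                 ≈⟨ -‿involutive _ ⟨
    - - (a *ᵣ b)                           ≈⟨ -‿cong (-‿distribˡ-* _ _) ⟩
    - (- a *ᵣ b)                           ≈⟨ -‿distribʳ-* _ _ ⟩
    - a *ᵣ - b                             ∎
    where
    a b : Carrier
    a = suc m ⨰ 1#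
    b = suc n ⨰ 1#

  fromℤ-homomorphism : ℤ.+-*-rawRing -Raw-AlmostCommutative⟶ fromCommutativeRing R
  fromℤ-homomorphism = record
    { ⟦_⟧ = fromℤ ; +-homo = fromℤ-+ ; *-homo = fromℤ-* ; -‿homo = fromℤ-neg
    ; 0-homo = refl ; 1-homo = +-identityʳ 1# }

  fromℤ-equal? : ∀ x y → Maybe (fromℤ x ≈ fromℤ y)
  fromℤ-equal? x y with x ℤ.≟ y
  ... | yes ≡.refl = just refl
  ... | no _       = nothing

  open RingSolver ℤ.+-*-rawRing (fromCommutativeRing R) fromℤ-homomorphism fromℤ-equal? public
    using (solve; _:+_; _:*_; _:-_; :-_; con; _:=_)

module _ {c ℓ : Level} (R : CommutativeRing c ℓ) where
  open CommutativeRing R hiding (zero; _+_; _*_)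
  open CommutativeRing R using () renaming (_+_ to _+ᵣ_; _*_ to _*ᵣ_)
  open import Algebra.Properties.Ring ring using (-‿involutive; -‿distribˡ-*; -0#≈0#)
  open WithRing R
  open IntegerCoefficientSolver R using (solve; _:+_; _:*_; _:-_; :-_; con; _:=_)
  module ≈-Reasoning = SetoidReasoning setoid

  -- Formal power series

  infix 4 _≋_
  record _≋_ (f g : Series) : Set ℓ where
    constructor pointwise
    field at : ∀ m → f m ≈ g m
  open _≋_ public

  ≋-refl : ∀ {f} → f ≋ f
  ≋-refl = pointwise λ _ → refl

  ≋-sym : ∀ {f g} → f ≋ g → g ≋ f
  ≋-sym p = pointwise λ m → sym (at p m)

  ≋-trans : ∀ {f g h} → f ≋ g → g ≋ h → f ≋ h
  ≋-trans p q = pointwise λ m → trans (at p m) (at q m)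

  ≋-setoid : Setoid c ℓ
  ≋-setoid = record
    { Carrier = Series ; _≈_ = _≋_
    ; isEquivalence = record { refl = ≋-refl ; sym = ≋-sym ; trans = ≋-trans } }

  module ≋-Reasoning = SetoidReasoning ≋-setoid

  ≡⇒≋ : ∀ {f g} → f ≡ g → f ≋ g
  ≡⇒≋ ≡.refl = ≋-refl

  infixl 6 _⊕_
  _⊕_ : Series → Series → Series
  (f ⊕ g) m = f m +ᵣ g m

  0ₛ : Series
  0ₛ _ = 0#

  step : Carrier → Series → Series → Series
  step a f g = scale a (mulX f) ⊖ g

  scale-cong : ∀ {a b f g} → a ≈ b → f ≋ g → scale a f ≋ scale b g
  scale-cong p q = pointwise λ m → *-cong p (at q m)

  mulX-cong : ∀ {f g} → f ≋ g → mulX f ≋ mulX g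
  mulX-cong p = pointwise λ { zero → refl ; (suc m) → at p m }

  ⊖-cong : ∀ {f f′ g g′} → f ≋ f′ → g ≋ g′ → (f ⊖ g) ≋ (f′ ⊖ g′)
  ⊖-cong p q = pointwise λ m → +-cong (at p m) (-‿cong (at q m))

  step-cong : ∀ {a b f f′ g g′} → a ≈ b → f ≋ f′ → g ≋ g′ → step a f g ≋ step b f′ g′
  step-cong p q r = ⊖-cong (scale-cong p (mulX-cong q)) r

  mulX-scale : ∀ a f → mulX (scale a f) ≋ scale a (mulX f)
  mulX-scale a f = pointwise λ { zero → sym (zeroʳ a) ; (suc m) → refl }

  sumTo-cong : ∀ {f g} m → (∀ i → i ≤ m → f i ≈ g i) → sumTo f m ≈ sumTo g m
  sumTo-cong zero    p = p 0 z≤n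
  sumTo-cong (suc m) p = +-cong (sumTo-cong m λ i i≤m → p i (ℕ.m≤n⇒m≤1+n i≤m)) (p (suc m) ℕ.≤-refl)

  sumTo-uncons : ∀ f m → sumTo f (suc m) ≈ f 0 +ᵣ sumTo (λ i → f (suc i)) m
  sumTo-uncons f zero    = refl
  sumTo-uncons f (suc m) = trans (+-congʳ (sumTo-uncons f m)) (+-assoc _ _ _)

  sumTo-+ : ∀ f g m → sumTo (λ i → f i +ᵣ g i) m ≈ sumTo f m +ᵣ sumTo g m
  sumTo-+ f g zero    = refl
  sumTo-+ f g (suc m) = trans (+-congʳ (sumTo-+ f g m))
    (solve 4 (λ a b x y → (a :+ b) :+ (x :+ y) := (a :+ x) :+ (b :+ y)) refl _ _ _ _)

  sumTo-neg : ∀ f m → sumTo (λ i → - f i) m ≈ - sumTo f m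
  sumTo-neg f zero    = refl
  sumTo-neg f (suc m) = trans (+-congʳ (sumTo-neg f m))
    (solve 2 (λ a b → (:- a) :+ (:- b) := :- (a :+ b)) refl _ _)

  sumTo-*ˡ : ∀ a f m → sumTo (λ i → a *ᵣ f i) m ≈ a *ᵣ sumTo f m
  sumTo-*ˡ a f zero    = refl
  sumTo-*ˡ a f (suc m) = trans (+-congʳ (sumTo-*ˡ a f m)) (sym (distribˡ _ _ _))

  sumTo-0 : ∀ f m → (∀ i → f i ≈ 0#) → sumTo f m ≈ 0#
  sumTo-0 f zero    p = p 0
  sumTo-0 f (suc m) p = trans (+-cong (sumTo-0 f m p) (p (suc m))) (+-identityʳ 0#)

  ⊛-cong : ∀ {f f′ g g′} → f ≋ f′ → g ≋ g′ → (f ⊛ g) ≋ (f′ ⊛ g′)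
  ⊛-cong p q = pointwise λ m → sumTo-cong m λ i _ → *-cong (at p i) (at q (m ∸ i))

  ⊛-distribʳ-⊖ : ∀ f g h → ((f ⊖ g) ⊛ h) ≋ ((f ⊛ h) ⊖ (g ⊛ h))
  ⊛-distribʳ-⊖ f g h = pointwise λ m → begin
    sumTo (λ i → (f i - g i) *ᵣ h (m ∸ i)) m
      ≈⟨ sumTo-cong m (λ i _ → solve 3 (λ a b d → (a :- b) :* d := a :* d :+ (:- (b :* d))) refl _ _ _) ⟩
    sumTo (λ i → f i *ᵣ h (m ∸ i) +ᵣ - (g i *ᵣ h (m ∸ i))) m
      ≈⟨ trans (sumTo-+ _ _ m) (+-congˡ (sumTo-neg _ m)) ⟩
    ((f ⊛ h) ⊖ (g ⊛ h)) m ∎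
    where open ≈-Reasoning

  ⊛-distribˡ-⊖ : ∀ f g h → (f ⊛ (g ⊖ h)) ≋ ((f ⊛ g) ⊖ (f ⊛ h))
  ⊛-distribˡ-⊖ f g h = pointwise λ m → begin
    sumTo (λ i → f i *ᵣ (g (m ∸ i) - h (m ∸ i))) m
      ≈⟨ sumTo-cong m (λ i _ → solve 3 (λ a b d → d :* (a :- b) := d :* a :+ (:- (d :* b))) refl _ _ _) ⟩
    sumTo (λ i → f i *ᵣ g (m ∸ i) +ᵣ - (f i *ᵣ h (m ∸ i))) m
      ≈⟨ trans (sumTo-+ _ _ m) (+-congˡ (sumTo-neg _ m)) ⟩
    ((f ⊛ g) ⊖ (f ⊛ h)) m ∎
    where open ≈-Reasoning

  scale-⊛ : ∀ a f h → (scale a f ⊛ h) ≋ scale a (f ⊛ h)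
  scale-⊛ a f h = pointwise λ m → trans (sumTo-cong m λ i _ → *-assoc _ _ _) (sumTo-*ˡ a _ m)

  ⊛-scale : ∀ a f h → (f ⊛ scale a h) ≋ scale a (f ⊛ h)
  ⊛-scale a f h = pointwise λ m → trans
    (sumTo-cong m λ i _ → solve 3 (λ x y z → x :* (y :* z) := y :* (x :* z)) refl _ _ _)
    (sumTo-*ˡ a _ m)

  mulX-⊛ : ∀ f h → (mulX f ⊛ h) ≋ mulX (f ⊛ h)
  mulX-⊛ f h = pointwise λ
    { zero    → zeroˡ _
    ; (suc m) → begin
        sumTo (λ i → mulX f i *ᵣ h (suc m ∸ i)) (suc m)  ≈⟨ sumTo-uncons _ m ⟩
        0# *ᵣ h (suc m) +ᵣ (f ⊛ h) m                     ≈⟨ +-congʳ (zeroˡ _) ⟩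
        0# +ᵣ (f ⊛ h) m                                  ≈⟨ +-identityˡ _ ⟩
        (f ⊛ h) m                                        ∎ }
    where open ≈-Reasoning

  ⊛-mulX : ∀ f h → (f ⊛ mulX h) ≋ mulX (f ⊛ h)
  ⊛-mulX f h = pointwise λ
    { zero    → zeroʳ _
    ; (suc m) → begin
        sumTo (λ i → f i *ᵣ mulX h (suc m ∸ i)) m +ᵣ f (suc m) *ᵣ mulX h (m ∸ m)
          ≈⟨ +-cong (sumTo-cong m λ i i≤m → *-congˡ (reflexive (≡.cong (mulX h) (ℕ.+-∸-assoc 1 i≤m))))
                    (trans (*-congˡ (reflexive (≡.cong (mulX h) (ℕ.n∸n≡0 m)))) (zeroʳ _)) ⟩
        (f ⊛ h) m +ᵣ 0#   ≈⟨ +-identityʳ _ ⟩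
        (f ⊛ h) m         ∎ }
    where open ≈-Reasoning

  step-⊛ : ∀ a f g h → (step a f g ⊛ h) ≋ step a (f ⊛ h) (g ⊛ h)
  step-⊛ a f g h = ≋-trans (⊛-distribʳ-⊖ (scale a (mulX f)) g h)
    (⊖-cong (≋-trans (scale-⊛ a (mulX f) h) (scale-cong refl (mulX-⊛ f h))) (≋-refl {g ⊛ h}))

  ⊛-step : ∀ a f g h → (h ⊛ step a f g) ≋ step a (h ⊛ f) (h ⊛ g)
  ⊛-step a f g h = ≋-trans (⊛-distribˡ-⊖ h (scale a (mulX f)) g)
    (⊖-cong (≋-trans (⊛-scale a h (mulX f)) (scale-cong refl (⊛-mulX h f))) (≋-refl {h ⊛ g}))

  ⊛-zeroˡ : ∀ h → (0ₛ ⊛ h) ≋ 0ₛ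
  ⊛-zeroˡ h = pointwise λ m → sumTo-0 _ m λ _ → zeroˡ _

  ⊛-zeroʳ : ∀ h → (h ⊛ 0ₛ) ≋ 0ₛ
  ⊛-zeroʳ h = pointwise λ m → sumTo-0 _ m λ _ → zeroʳ _

  ⊛-identityˡ : ∀ h → (oneS ⊛ h) ≋ h
  ⊛-identityˡ h = pointwise λ
    { zero    → *-identityˡ _
    ; (suc m) → begin
        sumTo (λ i → oneS i *ᵣ h (suc m ∸ i)) (suc m)        ≈⟨ sumTo-uncons _ m ⟩
        1# *ᵣ h (suc m) +ᵣ sumTo (λ i → 0# *ᵣ h (m ∸ i)) m   ≈⟨ +-cong (*-identityˡ _) (sumTo-0 _ m λ _ → zeroˡ _) ⟩
        h (suc m) +ᵣ 0#                                      ≈⟨ +-identityʳ _ ⟩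
        h (suc m)                                            ∎ }
    where open ≈-Reasoning

  xS≋mulX-oneS : xS ≋ mulX oneS
  xS≋mulX-oneS = pointwise λ { zero → refl ; (suc zero) → refl ; (suc (suc m)) → refl }

  xS-⊛ : ∀ h → (xS ⊛ h) ≋ mulX h
  xS-⊛ h = ≋-trans (⊛-cong xS≋mulX-oneS (≋-refl {h})) (≋-trans (mulX-⊛ oneS h) (mulX-cong (⊛-identityˡ h)))

  -- Finite sums

  sumRange : (ℕ → Carrier) → ℕ → ℕ → Carrier
  sumRange f a zero    = 0#
  sumRange f a (suc n) = f a +ᵣ sumRange f (suc a) n

  sumRange-cong : ∀ {f g} a n → (∀ t → a ≤ t → t < a + n → f t ≈ g t) → sumRange f a n ≈ sumRange g a n
  sumRange-cong a zero    p = refl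
  sumRange-cong a (suc n) p = +-cong (p a ℕ.≤-refl (ℕ.m<m+n a (s≤s z≤n)))
    (sumRange-cong (suc a) n λ t a<t t< → p t (ℕ.<⇒≤ a<t) (ℕ.<-≤-trans t< (ℕ.≤-reflexive (≡.sym (ℕ.+-suc a n)))))

  sumRange-zero : ∀ f a n → (∀ t → a ≤ t → f t ≈ 0#) → sumRange f a n ≈ 0#
  sumRange-zero f a zero    p = refl
  sumRange-zero f a (suc n) p =
    trans (+-cong (p a ℕ.≤-refl) (sumRange-zero f (suc a) n λ t a<t → p t (ℕ.<⇒≤ a<t))) (+-identityʳ 0#)

  sumRange-*ˡ : ∀ a f j n → sumRange (λ t → a *ᵣ f t) j n ≈ a *ᵣ sumRange f j n
  sumRange-*ˡ a f j zero    = sym (zeroʳ a)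
  sumRange-*ˡ a f j (suc n) = trans (+-congˡ (sumRange-*ˡ a f (suc j) n)) (sym (distribˡ _ _ _))

  sumRange-*ʳ : ∀ a f j n → sumRange f j n *ᵣ a ≈ sumRange (λ t → f t *ᵣ a) j n
  sumRange-*ʳ a f j n = trans (*-comm _ _)
    (trans (sym (sumRange-*ˡ a f j n)) (sumRange-cong j n λ t _ _ → *-comm _ _))

  sumRange-++ : ∀ f a m n → sumRange f a (m + n) ≈ sumRange f a m +ᵣ sumRange f (a + m) n
  sumRange-++ f a zero n rewrite ℕ.+-identityʳ a = sym (+-identityˡ _)
  sumRange-++ f a (suc m) n rewrite ℕ.+-suc a m =
    trans (+-congˡ (sumRange-++ f (suc a) m n)) (sym (+-assoc _ _ _))

  sumRange-shift : ∀ f a n → sumRange f (suc a) n ≡ sumRange (λ i → f (suc i)) a n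
  sumRange-shift f a zero    = ≡.refl
  sumRange-shift f a (suc n) = ≡.cong (f (suc a) +ᵣ_) (sumRange-shift f (suc a) n)

  sumRange-single : ∀ f a n j → a ≤ j → j < a + n → (∀ i → i ≢ j → f i ≈ 0#) → sumRange f a n ≈ f j
  sumRange-single f a zero j a≤j j< p =
    ⊥-elim (ℕ.<-irrefl ≡.refl (ℕ.<-≤-trans j< (ℕ.≤-trans (ℕ.≤-reflexive (ℕ.+-identityʳ a)) a≤j)))
  sumRange-single f a (suc n) j a≤j j< p with a ℕ.≟ j
  ... | yes ≡.refl = trans (+-congˡ (sumRange-zero f (suc a) n λ i a<i → p i λ i≡a → ℕ.<-irrefl (≡.sym i≡a) a<i))
                           (+-identityʳ _)
  ... | no a≢j = trans (+-cong (p a a≢j)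
                              (sumRange-single f (suc a) n j (ℕ.≤∧≢⇒< a≤j a≢j)
                                               (ℕ.<-≤-trans j< (ℕ.≤-reflexive (ℕ.+-suc a n))) p))
                       (+-identityˡ _)

  -- The tests are written as suc j ≤ᵇ suc i, the form produced by altUp and altDown: for a variable j
  -- it does not reduce to j ≤ᵇ i.
  sumRange-≥ : ∀ f j n → j ≤ n → sumRange (λ i → if suc j ≤ᵇ suc i then f i else 0#) 0 n ≈ sumRange f j (n ∸ j)
  sumRange-≥ f j n j≤n = begin
    sumRange g 0 n                                 ≡⟨ ≡.cong (sumRange g 0) (ℕ.m+[n∸m]≡n j≤n) ⟨
    sumRange g 0 (j + (n ∸ j))                     ≈⟨ sumRange-++ g 0 j (n ∸ j) ⟩
    sumRange g 0 j +ᵣ sumRange g j (n ∸ j)         ≈⟨ +-cong (sumRange-cong 0 j λ i _ i<j → below i<j)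
                                                             (sumRange-cong j (n ∸ j) λ i j≤i _ → above j≤i) ⟩
    sumRange (λ _ → 0#) 0 j +ᵣ sumRange f j (n ∸ j) ≈⟨ +-congʳ (sumRange-zero _ 0 j λ _ _ → refl) ⟩
    0# +ᵣ sumRange f j (n ∸ j)                     ≈⟨ +-identityˡ _ ⟩
    sumRange f j (n ∸ j)                           ∎
    where
    open ≈-Reasoning
    g : ℕ → Carrier
    g i = if suc j ≤ᵇ suc i then f i else 0#
    below : ∀ {i} → i < j → g i ≈ 0#
    below i<j rewrite ≤ᵇ-false (s≤s i<j) = refl
    above : ∀ {i} → j ≤ i → g i ≈ f i
    above j≤i rewrite ≤ᵇ-true (s≤s j≤i) = refl

  sumRange-≤ : ∀ f t n → t < n → sumRange (λ i → if suc i ≤ᵇ suc t then f i else 0#) 0 n ≈ sumRange f 0 (suc t)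
  sumRange-≤ f t n t<n = begin
    sumRange g 0 n
      ≡⟨ ≡.cong (sumRange g 0) (ℕ.m+[n∸m]≡n t<n) ⟨
    sumRange g 0 (suc t + (n ∸ suc t))
      ≈⟨ sumRange-++ g 0 (suc t) (n ∸ suc t) ⟩
    sumRange g 0 (suc t) +ᵣ sumRange g (suc t) (n ∸ suc t)
      ≈⟨ +-cong (sumRange-cong 0 (suc t) λ i _ i≤t → below (ℕ.≤-pred i≤t))
                (sumRange-zero g (suc t) (n ∸ suc t) λ i t<i → above t<i) ⟩
    sumRange f 0 (suc t) +ᵣ 0#
      ≈⟨ +-identityʳ _ ⟩
    sumRange f 0 (suc t) ∎
    where
    open ≈-Reasoning
    g : ℕ → Carrier
    g i = if suc i ≤ᵇ suc t then f i else 0#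
    below : ∀ {i} → i ≤ t → g i ≈ f i
    below i≤t rewrite ≤ᵇ-true (s≤s i≤t) = refl
    above : ∀ {i} → t < i → g i ≈ 0#
    above t<i rewrite ≤ᵇ-false (s≤s t<i) = refl

  sumTo-sumRange : ∀ (H : ℕ → ℕ → Carrier) j n m →
    sumTo (λ i → sumRange (λ t → H t i) j n) m ≈ sumRange (λ t → sumTo (H t) m) j n
  sumTo-sumRange H j zero    m = sumTo-0 _ m λ _ → refl
  sumTo-sumRange H j (suc n) m = trans (sumTo-+ _ _ m) (+-congˡ (sumTo-sumRange H (suc j) n m))

  signPow-suc : ∀ n → signPow (suc n) ≈ - signPow n
  signPow-suc zero          = refl
  signPow-suc (suc zero)    = sym (-‿involutive _)
  signPow-suc (suc (suc n)) = signPow-suc n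

  signPow-+ : ∀ a b → signPow (a + b) ≈ signPow a *ᵣ signPow b
  signPow-+ zero    b = sym (*-identityˡ _)
  signPow-+ (suc a) b = begin
    signPow (suc a + b)            ≈⟨ signPow-suc (a + b) ⟩
    - signPow (a + b)              ≈⟨ -‿cong (signPow-+ a b) ⟩
    - (signPow a *ᵣ signPow b)     ≈⟨ -‿distribˡ-* _ _ ⟩
    - signPow a *ᵣ signPow b       ≈⟨ *-congʳ (signPow-suc a) ⟨
    signPow (suc a) *ᵣ signPow b   ∎
    where open ≈-Reasoning

  signPow-suc-* : ∀ n → signPow (suc n) *ᵣ signPow n ≈ - 1#
  signPow-suc-* zero          = *-identityʳ _
  signPow-suc-* (suc zero)    = *-identityˡ _
  signPow-suc-* (suc (suc n)) = signPow-suc-* n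

  ⊖-identityʳ : ∀ f → (f ⊖ 0ₛ) ≋ f
  ⊖-identityʳ f = pointwise λ m → trans (+-congˡ -0#≈0#) (+-identityʳ _)

  ⊖-swap : ∀ f g h → ((f ⊖ g) ⊖ h) ≋ ((f ⊖ h) ⊖ g)
  ⊖-swap f g h = pointwise λ m → solve 3 (λ u y z → (u :- y) :- z := (u :- z) :- y) refl (f m) (g m) (h m)

  -- Continuants and the Green function

  step-step : ∀ a b P Q R S → step b (step a P Q) (step a R S) ≋ step a (step b P R) (step b Q S)
  step-step a b P Q R S = pointwise λ
    { zero → solve 3 (λ a b s → b :* con (+ 0) :- (a :* con (+ 0) :- s) := a :* con (+ 0) :- (b :* con (+ 0) :- s))
               refl a b (S 0)
    ; (suc zero) → solve 5 (λ a b q r s → b :* (a :* con (+ 0) :- q) :- (a :* r :- s) := a :* (b :* con (+ 0) :- r) :- (b :* q :- s))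
               refl a b (Q 0) (R 0) (S 1)
    ; (suc (suc m)) → solve 6 (λ a b p q r s → b :* (a :* p :- q) :- (a :* r :- s) := a :* (b :* p :- r) :- (b :* q :- s))
               refl a b (P m) (Q (suc m)) (R (suc m)) (S (suc (suc m))) }

  -- continuant γ (n + 1) is the determinant of the n × n tridiagonal matrix with diagonal
  -- γ₀ x, …, γₙ₋₁ x and off-diagonal entries −1.
  continuant : (ℕ → Carrier) → ℕ → Series
  continuant γ zero          = 0ₛ
  continuant γ (suc zero)    = oneS
  continuant γ (suc (suc n)) = step (γ n) (continuant γ (suc n)) (continuant γ n)

  continuant-cong : ∀ {γ γ′} n → (∀ i → i < n → γ i ≈ γ′ i) → continuant γ (suc n) ≋ continuant γ′ (suc n)
  continuant-cong zero          p = ≋-refl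
  continuant-cong (suc zero)    p = step-cong (p 0 (s≤s z≤n)) ≋-refl ≋-refl
  continuant-cong (suc (suc n)) p = step-cong (p (suc n) ℕ.≤-refl)
    (continuant-cong (suc n) λ i i< → p i (ℕ.m≤n⇒m≤1+n i<))
    (continuant-cong n λ i i< → p i (ℕ.m≤n⇒m≤1+n (ℕ.m≤n⇒m≤1+n i<)))

  continuant-cong-≡ : ∀ {γ γ′} → (∀ i → γ i ≡ γ′ i) → ∀ n → continuant γ n ≋ continuant γ′ n
  continuant-cong-≡ p zero    = ≋-refl
  continuant-cong-≡ p (suc n) = continuant-cong n λ i _ → reflexive (p i)

  continuant-unfoldˡ : ∀ γ n → continuant γ (suc (suc n)) ≋
    step (γ 0) (continuant (λ i → γ (suc i)) (suc n)) (continuant (λ i → γ (suc (suc i))) n)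
  continuant-unfoldˡ γ zero          = ≋-refl
  continuant-unfoldˡ γ (suc zero)    = pointwise λ
    { zero → solve 3 (λ a b o → a :* con (+ 0) :- o := b :* con (+ 0) :- o) refl _ _ _
    ; (suc zero) → solve 2 (λ a b → a :* (b :* con (+ 0) :- con (+ 0)) :- con (+ 0) := b :* (a :* con (+ 0) :- con (+ 0)) :- con (+ 0))
               refl _ _
    ; (suc (suc m)) → solve 3 (λ a b x → a :* (b :* x :- con (+ 0)) :- con (+ 0) := b :* (a :* x :- con (+ 0)) :- con (+ 0))
               refl _ _ _ }
  continuant-unfoldˡ γ (suc (suc n)) =
    ≋-trans (step-cong refl (continuant-unfoldˡ γ (suc n)) (continuant-unfoldˡ γ n)) (step-step _ _ _ _ _ _)

  continuant-reverse : ∀ γ n → continuant γ (suc n) ≋ continuant (λ i → γ (n ∸ suc i)) (suc n)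
  continuant-reverse γ zero          = ≋-refl
  continuant-reverse γ (suc zero)    = ≋-refl
  continuant-reverse γ (suc (suc n)) =
    ≋-trans (step-cong refl (continuant-reverse γ (suc n)) (continuant-reverse γ n))
            (≋-sym (continuant-unfoldˡ (λ i → γ (suc (suc n) ∸ suc i)) (suc n)))

  -- Expanding the tridiagonal determinant along the cut between rows a and a + 1.
  continuant-+ : ∀ γ a n →
    ((continuant γ (suc a) ⊛ continuant (λ i → γ (a + i)) (suc n))
      ⊖ (continuant γ a ⊛ continuant (λ i → γ (suc a + i)) n))
    ≋ continuant γ (suc (a + n))
  continuant-+ γ zero n =
    ≋-trans (⊖-cong (⊛-identityˡ _) (⊛-zeroˡ (continuant (λ i → γ (suc i)) n))) (⊖-identityʳ _)
  continuant-+ γ (suc a) n = begin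
    (continuant γ (suc (suc a)) ⊛ B) ⊖ Z            ≈⟨ ⊖-cong (step-⊛ (γ a) _ _ B) ≋-refl ⟩
    (step (γ a) X Y ⊖ Z)                            ≈⟨ ⊖-swap _ Y Z ⟩
    (scale (γ a) (mulX X) ⊖ Z) ⊖ Y                  ≈⟨ ⊖-cong (⊛-step (γ a) B C (continuant γ (suc a))) ≋-refl ⟨
    (continuant γ (suc a) ⊛ step (γ a) B C) ⊖ Y     ≈⟨ ⊖-cong (⊛-cong ≋-refl unfold) ≋-refl ⟨
    (continuant γ (suc a) ⊛ continuant (λ i → γ (a + i)) (suc (suc n))) ⊖ Y
                                                    ≈⟨ continuant-+ γ a (suc n) ⟩
    continuant γ (suc (a + suc n))                  ≡⟨ ≡.cong (λ z → continuant γ (suc z)) (ℕ.+-suc a n) ⟩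
    continuant γ (suc (suc a + n))                  ∎
    where
    open ≋-Reasoning
    B C X Y Z : Series
    B = continuant (λ i → γ (suc a + i)) (suc n)
    C = continuant (λ i → γ (suc (suc a) + i)) n
    X = continuant γ (suc a) ⊛ B
    Y = continuant γ a ⊛ B
    Z = continuant γ (suc a) ⊛ C
    unfold : continuant (λ i → γ (a + i)) (suc (suc n)) ≋ step (γ a) B C
    unfold = ≋-trans (continuant-unfoldˡ (λ i → γ (a + i)) n)
      (step-cong (reflexive (≡.cong γ (ℕ.+-identityʳ a)))
                 (continuant-cong-≡ (λ i → ≡.cong γ (ℕ.+-suc a i)) (suc n))
                 (continuant-cong-≡ (λ i → ≡.cong γ (≡.trans (ℕ.+-suc a (suc i)) (≡.cong suc (ℕ.+-suc a i)))) n))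

  Q≋continuant : ∀ σ n → Q σ n ≋ continuant (coef σ) (suc n)
  Q≋continuant σ zero          = ≋-refl
  Q≋continuant σ (suc zero)    = ≋-trans (scale-cong refl xS≋mulX-oneS) (≋-sym (⊖-identityʳ _))
  Q≋continuant σ (suc (suc n)) = step-cong refl (Q≋continuant σ (suc n)) (Q≋continuant σ n)

  -- With M the N × N tridiagonal matrix of continuant γ (N + 1), green P = det M · (M⁻¹)_{P−1,q}
  -- for 1 ≤ P ≤ N (Cramer's rule).
  module Green (γ : ℕ → Carrier) (N q : ℕ) (q<N : q < N) where

    det : Series
    det = continuant γ (suc N)

    tailContinuant : ℕ → Series
    tailContinuant b = continuant (λ i → γ (b + i)) (suc N ∸ b)

    green : ℕ → Series
    green P = if P ≤ᵇ suc q
              then continuant γ P ⊛ tailContinuant (suc q)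
              else continuant γ (suc q) ⊛ tailContinuant P

    source : ℕ → Series
    source i = if i ≡ᵇ q then det else 0ₛ

    green-≤ : ∀ {P} → P ≤ suc q → green P ≡ (continuant γ P ⊛ tailContinuant (suc q))
    green-≤ P≤ rewrite ≤ᵇ-true P≤ = ≡.refl

    green-≥ : ∀ {P} → suc q ≤ P → green P ≡ (continuant γ (suc q) ⊛ tailContinuant P)
    green-≥ {P} q<P with ℕ.m≤n⇒m<n∨m≡n q<P
    ... | inj₁ q<P′  rewrite ≤ᵇ-false q<P′ = ≡.refl
    ... | inj₂ ≡.refl rewrite ≤ᵇ-true (ℕ.≤-refl {P}) = ≡.refl

    source-q : source q ≡ det
    source-q rewrite ≡ᵇ-true (≡.refl {x = q}) = ≡.refl

    source-≢ : ∀ {i} → i ≢ q → source i ≡ 0ₛ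
    source-≢ i≢q rewrite ≡ᵇ-false i≢q = ≡.refl

    green-zero : green 0 ≋ 0ₛ
    green-zero rewrite green-≤ {0} z≤n = ⊛-zeroˡ (tailContinuant (suc q))

    green-top : green (suc N) ≋ 0ₛ
    green-top rewrite green-≥ {suc N} (s≤s (ℕ.<⇒≤ q<N)) =
      ≋-trans (⊛-cong ≋-refl (≡⇒≋ (≡.cong (continuant _) (ℕ.n∸n≡0 N)))) (⊛-zeroʳ (continuant γ (suc q)))

    tailContinuant-unfold : ∀ i → i < N →
      tailContinuant i ≋ step (γ i) (tailContinuant (suc i)) (tailContinuant (suc (suc i)))
    tailContinuant-unfold i i<N = begin
      continuant (λ j → γ (i + j)) (suc N ∸ i)
        ≡⟨ ≡.cong (continuant _) (≡.trans (ℕ.+-∸-assoc 1 (ℕ.<⇒≤ i<N)) (≡.cong suc N∸i)) ⟩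
      continuant (λ j → γ (i + j)) (suc (suc n))
        ≈⟨ continuant-unfoldˡ (λ j → γ (i + j)) n ⟩
      step (γ (i + 0)) (continuant (λ j → γ (i + suc j)) (suc n)) (continuant (λ j → γ (i + suc (suc j))) n)
        ≈⟨ step-cong (reflexive (≡.cong γ (ℕ.+-identityʳ i)))
             (continuant-cong-≡ (λ j → ≡.cong γ (ℕ.+-suc i j)) (suc n))
             (continuant-cong-≡ (λ j → ≡.cong γ (≡.trans (ℕ.+-suc i (suc j)) (≡.cong suc (ℕ.+-suc i j)))) n) ⟩
      step (γ i) (continuant (λ j → γ (suc i + j)) (suc n)) (continuant (λ j → γ (suc (suc i) + j)) n)
        ≡⟨ ≡.cong (λ a → step (γ i) (continuant (λ j → γ (suc i + j)) a) (tailContinuant (suc (suc i)))) (≡.sym N∸i) ⟩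
      step (γ i) (tailContinuant (suc i)) (tailContinuant (suc (suc i))) ∎
      where
      open ≋-Reasoning
      n : ℕ
      n = N ∸ suc i
      N∸i : N ∸ i ≡ suc n
      N∸i = ℕ.+-∸-assoc 1 i<N

    private
      ⊕-from-⊖ˡ : ∀ {u y w} → w ≋ (u ⊖ y) → u ≋ (y ⊕ w ⊕ 0ₛ)
      ⊕-from-⊖ˡ {u} {y} p = pointwise λ m → sym (trans (+-congʳ (+-congˡ (at p m)))
        (solve 2 (λ a b → (b :+ (a :- b)) :+ con (+ 0) := a) refl (u m) (y m)))

      ⊕-from-⊖ʳ : ∀ {u y w} → y ≋ (u ⊖ w) → u ≋ (y ⊕ w ⊕ 0ₛ)
      ⊕-from-⊖ʳ {u} {w = w} p = pointwise λ m → sym (trans (+-congʳ (+-congʳ (at p m)))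
        (solve 2 (λ a b → ((a :- b) :+ b) :+ con (+ 0) := a) refl (u m) (w m)))

      ⊕-from-⊖⊖ : ∀ {u y w z d} → w ≋ (u ⊖ y) → (w ⊖ z) ≋ d → u ≋ (y ⊕ z ⊕ d)
      ⊕-from-⊖⊖ {u} {y} {w} {z} {d} p r = pointwise λ m → sym (begin
        (y m +ᵣ z m) +ᵣ d m                 ≈⟨ +-congˡ (sym (at r m)) ⟩
        (y m +ᵣ z m) +ᵣ (w m - z m)         ≈⟨ +-congˡ (+-congʳ (at p m)) ⟩
        (y m +ᵣ z m) +ᵣ ((u m - y m) - z m) ≈⟨ solve 3 (λ a b e → (b :+ e) :+ ((a :- b) :- e) := a) refl (u m) (y m) (z m) ⟩
        u m                                 ∎)
        where open ≈-Reasoning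

    -- M · green = det · e_q, row by row.
    green-recurrence : ∀ i → i < N →
      scale (γ i) (mulX (green (suc i))) ≋ (green i ⊕ green (suc (suc i)) ⊕ source i)
    green-recurrence i i<N with ℕ.<-cmp i q
    ... | tri< i<q _ _
      rewrite green-≤ (ℕ.m≤n⇒m≤1+n (ℕ.<⇒≤ i<q)) | green-≤ (ℕ.m≤n⇒m≤1+n i<q) | green-≤ (s≤s i<q)
            | source-≢ (ℕ.<⇒≢ i<q)
      = ⊕-from-⊖ˡ (step-⊛ (γ i) (continuant γ (suc i)) (continuant γ i) (tailContinuant (suc q)))
    ... | tri> _ _ q<i
      rewrite green-≥ q<i | green-≥ (ℕ.m≤n⇒m≤1+n q<i) | green-≥ (ℕ.m≤n⇒m≤1+n (ℕ.m≤n⇒m≤1+n q<i))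
            | source-≢ (ℕ.>⇒≢ q<i)
      = ⊕-from-⊖ʳ (≋-trans (⊛-cong ≋-refl (tailContinuant-unfold i i<N))
                           (⊛-step (γ i) (tailContinuant (suc i)) (tailContinuant (suc (suc i))) (continuant γ (suc q))))
    ... | tri≈ _ ≡.refl _
      rewrite green-≤ (ℕ.n≤1+n i) | green-≤ (ℕ.≤-refl {suc i}) | green-≥ (ℕ.n≤1+n (suc i)) | source-q
      = ⊕-from-⊖⊖ (step-⊛ (γ i) (continuant γ (suc i)) (continuant γ i) (tailContinuant (suc i)))
          (≋-trans (⊖-cong (⊛-cong ≋-refl (≡⇒≋ (≡.cong (continuant _) (ℕ.+-∸-assoc 1 i<N)))) ≋-refl)
            (≋-trans (continuant-+ γ (suc i) (N ∸ suc i))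
                     (≡⇒≋ (≡.cong (λ z → continuant γ (suc z)) (ℕ.m+[n∸m]≡n i<N)))))

  -- Weighted walks

  telescope-down : ∀ (F d : ℕ → Carrier) j n → F (j + n) ≈ 0# →
    (∀ t → j ≤ t → t < j + n → F t - F (suc t) ≈ d t) → F j ≈ sumRange d j n
  telescope-down F d j zero F≈0 diff = trans (reflexive (≡.cong F (≡.sym (ℕ.+-identityʳ j)))) F≈0
  telescope-down F d j (suc n) F≈0 diff = begin
    F j                              ≈⟨ solve 2 (λ a b → a := (a :- b) :+ b) refl _ _ ⟩
    (F j - F (suc j)) +ᵣ F (suc j)   ≈⟨ +-cong (diff j ℕ.≤-refl (ℕ.m<m+n j (s≤s z≤n)))
                                               (telescope-down F d (suc j) n F≈0′ diff′) ⟩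
    d j +ᵣ sumRange d (suc j) n      ∎
    where
    open ≈-Reasoning
    F≈0′ : F (suc j + n) ≈ 0#
    F≈0′ = trans (reflexive (≡.cong F (≡.sym (ℕ.+-suc j n)))) F≈0
    diff′ : ∀ t → suc j ≤ t → t < suc j + n → F t - F (suc t) ≈ d t
    diff′ t j<t t< = diff t (ℕ.<⇒≤ j<t) (ℕ.<-≤-trans t< (ℕ.≤-reflexive (≡.sym (ℕ.+-suc j n))))

  telescope-up : ∀ (F d : ℕ → Carrier) j → F 0 ≈ d 0 →
    (∀ t → t < j → F (suc t) - F t ≈ d (suc t)) → F j ≈ sumRange d 0 (suc j)
  telescope-up F d zero    F0 diff = trans F0 (sym (+-identityʳ _))
  telescope-up F d (suc j) F0 diff = begin
    F (suc j)                                    ≈⟨ solve 2 (λ a b → a := b :+ (a :- b)) refl _ _ ⟩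
    F j +ᵣ (F (suc j) - F j)                     ≈⟨ +-cong (telescope-up F d j F0 λ t t<j → diff t (ℕ.m≤n⇒m≤1+n t<j))
                                                           (diff j ℕ.≤-refl) ⟩
    sumRange d 0 (suc j) +ᵣ d (suc j)            ≈⟨ +-congˡ (+-identityʳ _) ⟨
    sumRange d 0 (suc j) +ᵣ sumRange d (suc j) 1 ≈⟨ sumRange-++ d 0 (suc j) 1 ⟨
    sumRange d 0 (suc j + 1)                     ≡⟨ ≡.cong (sumRange d 0) (ℕ.+-comm (suc j) 1) ⟩
    sumRange d 0 (suc (suc j))                   ∎
    where open ≈-Reasoning

  -- Positions 0, 1, …, 2k − 1 stand for V₁, A₁, V₂, A₂, …, position p having weight γ p.
  -- walkV j m (walkA j m) is the total weight of the sequences of m + 1 positions from 2 j (2 j + 1)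
  -- to q in which a V-position 2 j is followed by an A-position 2 t + 1 with t ≥ j, and an
  -- A-position 2 j + 1 by a V-position 2 u with u ≤ j.
  module Transfer (γ : ℕ → Carrier) (k q : ℕ) (q<2k : q < 2 * k) where
    open Green γ (2 * k) q q<2k public

    walkV walkA : ℕ → ℕ → Carrier
    walkV j zero    = if 2 * j ≡ᵇ q then γ (2 * j) else 0#
    walkV j (suc m) = γ (2 * j) *ᵣ sumRange (λ t → walkA t m) j (k ∸ j)
    walkA j zero    = if suc (2 * j) ≡ᵇ q then γ (suc (2 * j)) else 0#
    walkA j (suc m) = γ (suc (2 * j)) *ᵣ sumRange (λ u → walkV u m) 0 (suc j)

    greenV greenA : ℕ → Series
    greenV j = scale (signPow j) (green (suc (2 * j)))
    greenA j = scale (signPow j) (green (suc (suc (2 * j))))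

    private
      signed-recurrence : ∀ s s′ a b d c x → s′ ≈ - s → c *ᵣ x ≈ (a +ᵣ b) +ᵣ d →
                          s *ᵣ a - s′ *ᵣ b ≈ c *ᵣ (s *ᵣ x) - s *ᵣ d
      signed-recurrence s s′ a b d c x s′≈-s eq = begin
        s *ᵣ a - s′ *ᵣ b              ≈⟨ +-congˡ (-‿cong (*-congʳ s′≈-s)) ⟩
        s *ᵣ a - (- s) *ᵣ b           ≈⟨ solve 4 (λ s a b d → s :* a :- (:- s) :* b := s :* ((a :+ b) :+ d) :- s :* d)
                                               refl s a b d ⟩
        s *ᵣ ((a +ᵣ b) +ᵣ d) - s *ᵣ d ≈⟨ +-congʳ (*-congˡ (sym eq)) ⟩
        s *ᵣ (c *ᵣ x) - s *ᵣ d        ≈⟨ solve 4 (λ s c x d → s :* (c :* x) :- s :* d := c :* (s :* x) :- s :* d)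
                                               refl s c x d ⟩
        c *ᵣ (s *ᵣ x) - s *ᵣ d        ∎
        where open ≈-Reasoning

    greenV-difference : ∀ j → j < k →
      (greenV j ⊖ greenV (suc j)) ≋ step (γ (suc (2 * j))) (greenA j) (scale (signPow j) (source (suc (2 * j))))
    greenV-difference j j<k = pointwise λ m → begin
      signPow j *ᵣ green (suc (2 * j)) m - signPow (suc j) *ᵣ green (suc (2 * suc j)) m
        ≡⟨ ≡.cong (λ z → signPow j *ᵣ green (suc (2 * j)) m - signPow (suc j) *ᵣ green (suc z) m) (ℕ.*-suc 2 j) ⟩
      signPow j *ᵣ green (suc (2 * j)) m - signPow (suc j) *ᵣ green (suc (suc (suc (2 * j)))) m
        ≈⟨ signed-recurrence _ _ _ _ _ _ _ (signPow-suc j) (at (green-recurrence (suc (2 * j)) i<2k) m) ⟩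
      γ (suc (2 * j)) *ᵣ (signPow j *ᵣ mulX (green (suc (suc (2 * j)))) m) - signPow j *ᵣ source (suc (2 * j)) m
        ≈⟨ +-congʳ (*-congˡ (at (mulX-scale (signPow j) _) m)) ⟨
      step (γ (suc (2 * j))) (greenA j) (scale (signPow j) (source (suc (2 * j)))) m ∎
      where
      open ≈-Reasoning
      i<2k : suc (2 * j) < 2 * k
      i<2k = ℕ.<-≤-trans (ℕ.≤-reflexive (≡.sym (ℕ.*-suc 2 j))) (ℕ.*-monoʳ-≤ 2 j<k)

    greenA-difference : ∀ j → j < k →
      (greenA j ⊖ scale (- signPow j) (green (2 * j))) ≋ step (γ (2 * j)) (greenV j) (scale (signPow j) (source (2 * j)))
    greenA-difference j j<k = pointwise λ m → begin
      signPow j *ᵣ green (suc (suc (2 * j))) m - (- signPow j) *ᵣ green (2 * j) m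
        ≈⟨ solve 3 (λ s a b → s :* b :- (:- s) :* a := s :* a :- (:- s) :* b) refl (signPow j) (green (2 * j) m) _ ⟩
      signPow j *ᵣ green (2 * j) m - (- signPow j) *ᵣ green (suc (suc (2 * j))) m
        ≈⟨ signed-recurrence _ _ _ _ _ _ _ refl (at (green-recurrence (2 * j) (ℕ.*-monoʳ-< 2 j<k)) m) ⟩
      γ (2 * j) *ᵣ (signPow j *ᵣ mulX (green (suc (2 * j))) m) - signPow j *ᵣ source (2 * j) m
        ≈⟨ +-congʳ (*-congˡ (at (mulX-scale (signPow j) _) m)) ⟨
      step (γ (2 * j)) (greenV j) (scale (signPow j) (source (2 * j))) m ∎
      where open ≈-Reasoning

    ΔgreenV ΔgreenA : ℕ → Series
    ΔgreenV t = step (γ (suc (2 * t))) (greenA t) (scale (signPow t) (source (suc (2 * t))))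
    ΔgreenA u = step (γ (2 * u)) (greenV u) (scale (signPow u) (source (2 * u)))

    greenV-sum : ∀ j → j < k → ∀ m → greenV j m ≈ sumRange (λ t → ΔgreenV t m) j (k ∸ j)
    greenV-sum j j<k m = telescope-down (λ t → greenV t m) (λ t → ΔgreenV t m) j (k ∸ j) top diff
      where
      j+[k∸j]≡k : j + (k ∸ j) ≡ k
      j+[k∸j]≡k = ℕ.m+[n∸m]≡n (ℕ.<⇒≤ j<k)
      top : greenV (j + (k ∸ j)) m ≈ 0#
      top rewrite j+[k∸j]≡k = trans (*-congˡ (at green-top m)) (zeroʳ _)
      diff : ∀ t → j ≤ t → t < j + (k ∸ j) → greenV t m - greenV (suc t) m ≈ ΔgreenV t m
      diff t _ t< = at (greenV-difference t (ℕ.<-≤-trans t< (ℕ.≤-reflexive j+[k∸j]≡k))) m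

    greenA-sum : ∀ j → j < k → ∀ m → greenA j m ≈ sumRange (λ u → ΔgreenA u m) 0 (suc j)
    greenA-sum j j<k m = telescope-up (λ t → greenA t m) (λ u → ΔgreenA u m) j first diff
      where
      open ≈-Reasoning
      first : greenA 0 m ≈ ΔgreenA 0 m
      first = begin
        greenA 0 m                                 ≈⟨ solve 1 (λ a → a := a :- con (+ 0)) refl _ ⟩
        greenA 0 m - 0#                            ≈⟨ +-congˡ (-‿cong (trans (*-congˡ (at green-zero m)) (zeroʳ _))) ⟨
        greenA 0 m - (- 1#) *ᵣ green 0 m           ≈⟨ at (greenA-difference 0 (ℕ.≤-<-trans z≤n j<k)) m ⟩
        ΔgreenA 0 m                                ∎
      previous : ∀ t → greenA t m ≈ (- signPow (suc t)) *ᵣ green (2 * suc t) m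
      previous t = begin
        signPow t *ᵣ green (suc (suc (2 * t))) m   ≡⟨ ≡.cong (λ z → signPow t *ᵣ green z m) (ℕ.*-suc 2 t) ⟨
        signPow t *ᵣ green (2 * suc t) m           ≈⟨ *-congʳ (trans (-‿cong (signPow-suc t)) (-‿involutive _)) ⟨
        (- signPow (suc t)) *ᵣ green (2 * suc t) m ∎
      diff : ∀ t → t < j → greenA (suc t) m - greenA t m ≈ ΔgreenA (suc t) m
      diff t t<j = trans (+-congˡ (-‿cong (previous t)))
                         (at (greenA-difference (suc t) (ℕ.≤-<-trans t<j j<k)) m)

    κ : Carrier
    κ = signPow (suc ⌊ q /2⌋)

    weightedGreen : ℕ → Series → Series
    weightedGreen p G = scale (γ p) (source p ⊕ scale (γ q *ᵣ κ) (mulX G))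

    scale-step : ∀ p t → ⌊ p /2⌋ ≡ t → ∀ G →
      scale (γ q *ᵣ κ) (step (γ p) G (scale (signPow t) (source p))) ≋ weightedGreen p G
    scale-step p t ⌊p/2⌋≡t G = pointwise go
      where
      open ≈-Reasoning
      go : ∀ m → (γ q *ᵣ κ) *ᵣ (γ p *ᵣ mulX G m - signPow t *ᵣ source p m)
                 ≈ γ p *ᵣ (source p m +ᵣ (γ q *ᵣ κ) *ᵣ mulX G m)
      go m with p ℕ.≟ q
      ... | no p≢q rewrite source-≢ p≢q =
        solve 5 (λ b k a s X → (b :* k) :* (a :* X :- s :* con (+ 0)) := a :* (con (+ 0) :+ (b :* k) :* X))
          refl (γ q) κ (γ p) (signPow t) (mulX G m)
      ... | yes p≡q = begin
        (γ q *ᵣ κ) *ᵣ (a *ᵣ X - signPow t *ᵣ source p m)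
          ≈⟨ *-cong (*-congʳ γq≈a) (+-congˡ (-‿cong (*-congˡ source≈det))) ⟩
        (a *ᵣ κ) *ᵣ (a *ᵣ X - signPow t *ᵣ d)
          ≈⟨ solve 5 (λ a k s d X → (a :* k) :* (a :* X :- s :* d) := a :* ((a :* k) :* X) :- a :* ((k :* s) :* d))
                   refl a κ (signPow t) d X ⟩
        a *ᵣ ((a *ᵣ κ) *ᵣ X) - a *ᵣ ((κ *ᵣ signPow t) *ᵣ d)
          ≈⟨ +-congˡ (-‿cong (*-congˡ (*-congʳ κ·signPow≈-1))) ⟩
        a *ᵣ ((a *ᵣ κ) *ᵣ X) - a *ᵣ ((- 1#) *ᵣ d)
          ≈⟨ solve 4 (λ a y d o → a :* y :- a :* ((:- o) :* d) := a :* (o :* d :+ y)) refl a ((a *ᵣ κ) *ᵣ X) d 1# ⟩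
        a *ᵣ (1# *ᵣ d +ᵣ (a *ᵣ κ) *ᵣ X)
          ≈⟨ *-congˡ (+-cong (trans (*-identityˡ d) (sym source≈det)) (*-congʳ (*-congʳ (sym γq≈a)))) ⟩
        a *ᵣ (source p m +ᵣ (γ q *ᵣ κ) *ᵣ X) ∎
        where
        a d X : Carrier
        a = γ p
        d = det m
        X = mulX G m
        γq≈a : γ q ≈ a
        γq≈a = reflexive (≡.cong γ (≡.sym p≡q))
        source≈det : source p m ≈ d
        source≈det = reflexive (≡.trans (≡.cong (λ i → source i m) p≡q) (≡.cong (λ S → S m) source-q))
        κ·signPow≈-1 : κ *ᵣ signPow t ≈ - 1#
        κ·signPow≈-1 = ≡.subst (λ z → signPow (suc z) *ᵣ signPow t ≈ - 1#)
                               (≡.trans (≡.sym ⌊p/2⌋≡t) (≡.cong ⌊_/2⌋ p≡q)) (signPow-suc-* t)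

    walk-start-⊛ : ∀ p m → (if p ≡ᵇ q then γ p else 0#) *ᵣ det m ≈ γ p *ᵣ source p m
    walk-start-⊛ p m with p ℕ.≟ q
    ... | yes p≡q rewrite ≡ᵇ-true p≡q = refl
    ... | no p≢q  rewrite ≡ᵇ-false p≢q = trans (zeroˡ _) (sym (zeroʳ _))

    -- weightedGreen satisfies the transfer equations defining the walks (via greenV-sum, greenA-sum
    -- and scale-step), so walk ⊛ det and weightedGreen agree coefficient by coefficient.
    walk-⊛-det : ∀ m → (∀ j → j < k → (walkV j ⊛ det) m ≈ weightedGreen (2 * j) (greenV j) m)
                     × (∀ j → j < k → (walkA j ⊛ det) m ≈ weightedGreen (suc (2 * j)) (greenA j) m)
    walk-⊛-det zero = (λ j _ → base (2 * j) {greenV j}) , (λ j _ → base (suc (2 * j)) {greenA j})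
      where
      base : ∀ p {G} → (if p ≡ᵇ q then γ p else 0#) *ᵣ det 0 ≈ weightedGreen p G 0
      base p = trans (walk-start-⊛ p 0) (*-congˡ (sym (trans (+-congˡ (zeroʳ _)) (+-identityʳ _))))
    walk-⊛-det (suc m) = fromV , fromA
      where
      open ≈-Reasoning
      fromV : ∀ j → j < k → (walkV j ⊛ det) (suc m) ≈ weightedGreen (2 * j) (greenV j) (suc m)
      fromV j j<k = begin
        (walkV j ⊛ det) (suc m)
          ≈⟨ sumTo-uncons _ m ⟩
        walkV j 0 *ᵣ det (suc m) +ᵣ sumTo (λ i → (a *ᵣ sumRange (λ t → walkA t i) j n) *ᵣ det (m ∸ i)) m
          ≈⟨ +-cong (walk-start-⊛ (2 * j) (suc m))
                    (sumTo-cong m λ i _ → trans (*-assoc _ _ _) (*-congˡ (sumRange-*ʳ _ _ j n))) ⟩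
        a *ᵣ source (2 * j) (suc m) +ᵣ sumTo (λ i → a *ᵣ sumRange (λ t → walkA t i *ᵣ det (m ∸ i)) j n) m
          ≈⟨ +-congˡ (trans (sumTo-*ˡ _ _ m) (*-congˡ (sumTo-sumRange (λ t i → walkA t i *ᵣ det (m ∸ i)) j n m))) ⟩
        a *ᵣ source (2 * j) (suc m) +ᵣ a *ᵣ sumRange (λ t → (walkA t ⊛ det) m) j n
          ≈⟨ +-congˡ (*-congˡ (sumRange-cong j n λ t _ t< →
                trans (proj₂ (walk-⊛-det m) t (ℕ.<-≤-trans t< (ℕ.≤-reflexive j+n≡k)))
                      (sym (at (scale-step (suc (2 * t)) t (⌊1+2n/2⌋≡n t) (greenA t)) m)))) ⟩
        a *ᵣ source (2 * j) (suc m) +ᵣ a *ᵣ sumRange (λ t → (γ q *ᵣ κ) *ᵣ ΔgreenV t m) j n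
          ≈⟨ +-congˡ (*-congˡ (trans (sumRange-*ˡ _ _ j n) (*-congˡ (sym (greenV-sum j j<k m))))) ⟩
        a *ᵣ source (2 * j) (suc m) +ᵣ a *ᵣ ((γ q *ᵣ κ) *ᵣ greenV j m)
          ≈⟨ distribˡ _ _ _ ⟨
        weightedGreen (2 * j) (greenV j) (suc m) ∎
        where
        a : Carrier
        a = γ (2 * j)
        n : ℕ
        n = k ∸ j
        j+n≡k : j + n ≡ k
        j+n≡k = ℕ.m+[n∸m]≡n (ℕ.<⇒≤ j<k)
      fromA : ∀ j → j < k → (walkA j ⊛ det) (suc m) ≈ weightedGreen (suc (2 * j)) (greenA j) (suc m)
      fromA j j<k = begin
        (walkA j ⊛ det) (suc m)
          ≈⟨ sumTo-uncons _ m ⟩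
        walkA j 0 *ᵣ det (suc m) +ᵣ sumTo (λ i → (a *ᵣ sumRange (λ u → walkV u i) 0 (suc j)) *ᵣ det (m ∸ i)) m
          ≈⟨ +-cong (walk-start-⊛ (suc (2 * j)) (suc m))
                    (sumTo-cong m λ i _ → trans (*-assoc _ _ _) (*-congˡ (sumRange-*ʳ _ _ 0 (suc j)))) ⟩
        a *ᵣ source (suc (2 * j)) (suc m) +ᵣ sumTo (λ i → a *ᵣ sumRange (λ u → walkV u i *ᵣ det (m ∸ i)) 0 (suc j)) m
          ≈⟨ +-congˡ (trans (sumTo-*ˡ _ _ m) (*-congˡ (sumTo-sumRange (λ u i → walkV u i *ᵣ det (m ∸ i)) 0 (suc j) m))) ⟩
        a *ᵣ source (suc (2 * j)) (suc m) +ᵣ a *ᵣ sumRange (λ u → (walkV u ⊛ det) m) 0 (suc j)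
          ≈⟨ +-congˡ (*-congˡ (sumRange-cong 0 (suc j) λ u _ u≤j →
                trans (proj₁ (walk-⊛-det m) u (ℕ.≤-<-trans (ℕ.≤-pred u≤j) j<k))
                      (sym (at (scale-step (2 * u) u (⌊2n/2⌋≡n u) (greenV u)) m)))) ⟩
        a *ᵣ source (suc (2 * j)) (suc m) +ᵣ a *ᵣ sumRange (λ u → (γ q *ᵣ κ) *ᵣ ΔgreenA u m) 0 (suc j)
          ≈⟨ +-congˡ (*-congˡ (trans (sumRange-*ˡ _ _ 0 (suc j)) (*-congˡ (sym (greenA-sum j j<k m))))) ⟩
        a *ᵣ source (suc (2 * j)) (suc m) +ᵣ a *ᵣ ((γ q *ᵣ κ) *ᵣ greenA j m)
          ≈⟨ distribˡ _ _ _ ⟨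
        weightedGreen (suc (2 * j)) (greenA j) (suc m) ∎
        where
        a : Carrier
        a = γ (suc (2 * j))

  -- Alternating sequences

  module Enumeration (A V : ℕ → Carrier) (k s : ℕ) where

    σ : Assign
    σ = (A , V)

    sumList : List (List ℕ) → (List ℕ → Carrier) → Carrier
    sumList xs ψ = foldr (λ l acc → ψ l +ᵣ acc) 0# xs

    sumSeqs : ℕ → (List ℕ → Carrier) → Carrier
    sumSeqs n = sumList (allSeqs k n)

    sumList-++ : ∀ xs ys ψ → sumList (xs ++ ys) ψ ≈ sumList xs ψ +ᵣ sumList ys ψ
    sumList-++ []       ys ψ = sym (+-identityˡ _)
    sumList-++ (x ∷ xs) ys ψ = trans (+-congˡ (sumList-++ xs ys ψ)) (sym (+-assoc _ _ _))

    sumList-map-∷ : ∀ a ys ψ → sumList (map (a ∷_) ys) ψ ≡ sumList ys (λ l → ψ (a ∷ l))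
    sumList-map-∷ a []       ψ = ≡.refl
    sumList-map-∷ a (y ∷ ys) ψ = ≡.cong (ψ (a ∷ y) +ᵣ_) (sumList-map-∷ a ys ψ)

    sumList-cong : ∀ xs {ψ ψ′} → (∀ l → ψ l ≈ ψ′ l) → sumList xs ψ ≈ sumList xs ψ′
    sumList-cong []       p = refl
    sumList-cong (x ∷ xs) p = +-cong (p x) (sumList-cong xs p)

    sumList-zero : ∀ xs {ψ} → (∀ l → ψ l ≈ 0#) → sumList xs ψ ≈ 0#
    sumList-zero []       p = refl
    sumList-zero (x ∷ xs) p = trans (+-cong (p x) (sumList-zero xs p)) (+-identityʳ 0#)

    sumList-*ˡ : ∀ xs a ψ → sumList xs (λ l → a *ᵣ ψ l) ≈ a *ᵣ sumList xs ψ
    sumList-*ˡ []       a ψ = sym (zeroʳ a)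
    sumList-*ˡ (x ∷ xs) a ψ = trans (+-congˡ (sumList-*ˡ xs a ψ)) (sym (distribˡ _ _ _))

    sumSeqs-suc : ∀ n ψ → sumSeqs (suc n) ψ ≈ sumRange (λ i → sumSeqs n (λ l → ψ (suc i ∷ l))) 0 k
    sumSeqs-suc n ψ = split id k
      where
      open ≈-Reasoning
      prepend : List ℕ → List (List ℕ)
      prepend = concatMap (λ a → map (a ∷_) (allSeqs k n))
      split : ∀ g m → sumList (prepend (map suc (applyUpTo g m))) ψ
                      ≈ sumRange (λ i → sumSeqs n (λ l → ψ (suc (g i) ∷ l))) 0 m
      split g zero    = refl
      split g (suc m) = begin
        sumList (map (suc (g 0) ∷_) (allSeqs k n) ++ prepend (map suc (applyUpTo (λ i → g (suc i)) m))) ψ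
          ≈⟨ sumList-++ (map (suc (g 0) ∷_) (allSeqs k n)) _ ψ ⟩
        sumList (map (suc (g 0) ∷_) (allSeqs k n)) ψ +ᵣ sumList (prepend (map suc (applyUpTo (λ i → g (suc i)) m))) ψ
          ≈⟨ +-cong (reflexive (sumList-map-∷ (suc (g 0)) (allSeqs k n) ψ)) (split (λ i → g (suc i)) m) ⟩
        sumSeqs n (λ l → ψ (suc (g 0) ∷ l)) +ᵣ sumRange (λ i → sumSeqs n (λ l → ψ (suc (g (suc i)) ∷ l))) 0 m
          ≡⟨ ≡.cong (_ +ᵣ_) (sumRange-shift (λ i → sumSeqs n (λ l → ψ (suc (g i) ∷ l))) 0 m) ⟨
        sumRange (λ i → sumSeqs n (λ l → ψ (suc (g i) ∷ l))) 0 (suc m) ∎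

    gfUp gfDown : ℕ → ℕ → Carrier
    gfUp   n r = sumSeqs n (λ l → if altUp (r ∷ l) ∧ lastIs s (r ∷ l) then wOdd σ (r ∷ l) else 0#)
    gfDown n t = sumSeqs n (λ l → if altDown (t ∷ l) ∧ lastIs s (t ∷ l) then wEven σ (t ∷ l) else 0#)

    private
      if-*ˡ : ∀ b a x → (if b then a *ᵣ x else 0#) ≈ a *ᵣ (if b then x else 0#)
      if-*ˡ true  a x = refl
      if-*ˡ false a x = sym (zeroʳ a)

      sumSeqs-if-*ˡ : ∀ n (b : List ℕ → Bool) a (w : List ℕ → Carrier) →
        sumSeqs n (λ l → if b l then a *ᵣ w l else 0#) ≈ a *ᵣ sumSeqs n (λ l → if b l then w l else 0#)
      sumSeqs-if-*ˡ n b a w = trans (sumList-cong (allSeqs k n) λ l → if-*ˡ (b l) a (w l))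
                                    (sumList-*ˡ (allSeqs k n) a _)

      gfUp-after : ∀ n r a →
        sumSeqs n (λ l → if altUp (r ∷ a ∷ l) ∧ lastIs s (r ∷ a ∷ l) then wOdd σ (r ∷ a ∷ l) else 0#)
          ≈ (if r ≤ᵇ a then V r *ᵣ gfDown n a else 0#)
      gfUp-after n r a with r ≤ᵇ a
      ... | true  = sumSeqs-if-*ˡ n (λ l → altDown (a ∷ l) ∧ lastIs s (a ∷ l)) (V r) (λ l → wEven σ (a ∷ l))
      ... | false = sumList-zero (allSeqs k n) λ _ → refl

      gfDown-after : ∀ n t a →
        sumSeqs n (λ l → if altDown (t ∷ a ∷ l) ∧ lastIs s (t ∷ a ∷ l) then wEven σ (t ∷ a ∷ l) else 0#)
          ≈ (if a ≤ᵇ t then A t *ᵣ gfUp n a else 0#)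
      gfDown-after n t a with a ≤ᵇ t
      ... | true  = sumSeqs-if-*ˡ n (λ l → altUp (a ∷ l) ∧ lastIs s (a ∷ l)) (A t) (λ l → wOdd σ (a ∷ l))
      ... | false = sumList-zero (allSeqs k n) λ _ → refl

    gfUp-suc : ∀ n r → gfUp (suc n) r ≈ V r *ᵣ sumRange (λ i → if r ≤ᵇ suc i then gfDown n (suc i) else 0#) 0 k
    gfUp-suc n r = trans (sumSeqs-suc n _)
      (trans (sumRange-cong 0 k λ i _ _ → trans (gfUp-after n r (suc i)) (if-*ˡ (r ≤ᵇ suc i) (V r) _))
             (sumRange-*ˡ (V r) _ 0 k))

    gfDown-suc : ∀ n t → gfDown (suc n) t ≈ A t *ᵣ sumRange (λ i → if suc i ≤ᵇ t then gfUp n (suc i) else 0#) 0 k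
    gfDown-suc n t = trans (sumSeqs-suc n _)
      (trans (sumRange-cong 0 k λ i _ _ → trans (gfDown-after n t (suc i)) (if-*ˡ (suc i ≤ᵇ t) (A t) _))
             (sumRange-*ˡ (A t) _ 0 k))

    gfUp-zero : ∀ r → gfUp 0 r ≈ (if r ≡ᵇ s then V r else 0#)
    gfUp-zero r with r ≡ᵇ s
    ... | true  = trans (+-identityʳ _) (*-identityʳ _)
    ... | false = +-identityʳ _

    gfDown-zero : ∀ t → gfDown 0 t ≈ (if t ≡ᵇ s then A t else 0#)
    gfDown-zero t with t ≡ᵇ s
    ... | true  = trans (+-identityʳ _) (*-identityʳ _)
    ... | false = +-identityʳ _

    GF≈gfUp : ∀ n j → j < k → GF σ k (suc n) (suc j) s ≈ gfUp n (suc j)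
    GF≈gfUp n j j<k = trans (sumSeqs-suc n member)
      (trans (sumRange-single _ 0 k j z≤n j<k λ i i≢j → sumList-zero (allSeqs k n) λ l → other i≢j l)
             (sumList-cong (allSeqs k n) λ l → first l))
      where
      member : List ℕ → Carrier
      member l = if inA (suc j) s l then wOdd σ l else 0#
      other : ∀ {i} → i ≢ j → ∀ l → member (suc i ∷ l) ≈ 0#
      other {i} i≢j l rewrite ≡ᵇ-false i≢j with altUp (suc i ∷ l)
      ... | true  = refl
      ... | false = refl
      first : ∀ l → member (suc j ∷ l) ≈ (if altUp (suc j ∷ l) ∧ lastIs s (suc j ∷ l) then wOdd σ (suc j ∷ l) else 0#)
      first l rewrite ≡ᵇ-true (≡.refl {x = j}) = refl

  coef-even : ∀ σ t → coef σ (2 * t) ≡ proj₂ σ (suc t)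
  coef-even σ zero    = ≡.refl
  coef-even σ (suc t) = ≡.trans (≡.cong (coef σ) (ℕ.*-suc 2 t)) (coef-even _ t)

  coef-odd : ∀ σ t → coef σ (suc (2 * t)) ≡ proj₁ σ (suc t)
  coef-odd σ zero    = ≡.refl
  coef-odd σ (suc t) = ≡.trans (≡.cong (λ z → coef σ (suc z)) (ℕ.*-suc 2 t)) (coef-odd _ t)

  -- Whether a walk of m steps ending at q can start at a V-position depends only on the parity of m;
  -- parity m says whether it can.
  module Matching (A V : ℕ → Carrier) (k q : ℕ) (q<2k : q < 2 * k) (s : ℕ)
                  (parity : ℕ → Bool) (parity-suc : ∀ m → parity (suc m) ≡ not (parity m)) where
    open Transfer (coef (A , V)) k q q<2k public
    open Enumeration A V k s public

    only : Bool → Carrier → Carrier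
    only b x = if b then x else 0#

    WalksMatch : ℕ → Set ℓ
    WalksMatch m = (∀ j → j < k → walkV j m ≈ only (parity m) (gfUp m (suc j)))
                 × (∀ j → j < k → walkA j m ≈ only (not (parity m)) (gfDown m (suc j)))

    walks-match-suc : ∀ m → WalksMatch m → WalksMatch (suc m)
    walks-match-suc m (ihV , ihA) rewrite parity-suc m with parity m
    ... | true  = (λ j j<k → trans (*-congˡ (trans (walkA-sum j j<k) (sumRange-zero _ j (k ∸ j) λ _ _ → refl))) (zeroʳ _))
                , λ j j<k → begin
                    coef σ (suc (2 * j)) *ᵣ sumRange (λ u → walkV u m) 0 (suc j)
                      ≈⟨ *-cong (reflexive (coef-odd σ j)) (walkV-sum j j<k) ⟩
                    A (suc j) *ᵣ sumRange (λ u → gfUp m (suc u)) 0 (suc j)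
                      ≈⟨ *-congˡ (sumRange-≤ (λ u → gfUp m (suc u)) j k j<k) ⟨
                    A (suc j) *ᵣ sumRange (λ i → if suc i ≤ᵇ suc j then gfUp m (suc i) else 0#) 0 k
                      ≈⟨ gfDown-suc m (suc j) ⟨
                    gfDown (suc m) (suc j) ∎
      where
      open ≈-Reasoning
      walkA-sum : ∀ j → j < k → sumRange (λ t → walkA t m) j (k ∸ j) ≈ sumRange (λ _ → 0#) j (k ∸ j)
      walkA-sum j j<k = sumRange-cong j (k ∸ j) λ t _ t< →
        ihA t (ℕ.<-≤-trans t< (ℕ.≤-reflexive (ℕ.m+[n∸m]≡n (ℕ.<⇒≤ j<k))))
      walkV-sum : ∀ j → j < k → sumRange (λ u → walkV u m) 0 (suc j) ≈ sumRange (λ u → gfUp m (suc u)) 0 (suc j)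
      walkV-sum j j<k = sumRange-cong 0 (suc j) λ u _ u≤j → ihV u (ℕ.≤-<-trans (ℕ.≤-pred u≤j) j<k)
    ... | false = (λ j j<k → begin
                    coef σ (2 * j) *ᵣ sumRange (λ t → walkA t m) j (k ∸ j)
                      ≈⟨ *-cong (reflexive (coef-even σ j)) (walkA-sum j j<k) ⟩
                    V (suc j) *ᵣ sumRange (λ t → gfDown m (suc t)) j (k ∸ j)
                      ≈⟨ *-congˡ (sumRange-≥ (λ t → gfDown m (suc t)) j k (ℕ.<⇒≤ j<k)) ⟨
                    V (suc j) *ᵣ sumRange (λ i → if suc j ≤ᵇ suc i then gfDown m (suc i) else 0#) 0 k
                      ≈⟨ gfUp-suc m (suc j) ⟨
                    gfUp (suc m) (suc j) ∎)
                , λ j j<k → trans (*-congˡ (trans (walkV-sum j j<k) (sumRange-zero _ 0 (suc j) λ _ _ → refl))) (zeroʳ _)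
      where
      open ≈-Reasoning
      walkA-sum : ∀ j → j < k → sumRange (λ t → walkA t m) j (k ∸ j) ≈ sumRange (λ t → gfDown m (suc t)) j (k ∸ j)
      walkA-sum j j<k = sumRange-cong j (k ∸ j) λ t _ t< →
        ihA t (ℕ.<-≤-trans t< (ℕ.≤-reflexive (ℕ.m+[n∸m]≡n (ℕ.<⇒≤ j<k))))
      walkV-sum : ∀ j → j < k → sumRange (λ u → walkV u m) 0 (suc j) ≈ sumRange (λ _ → 0#) 0 (suc j)
      walkV-sum j j<k = sumRange-cong 0 (suc j) λ u _ u≤j → ihV u (ℕ.≤-<-trans (ℕ.≤-pred u≤j) j<k)

    walks-match : WalksMatch 0 → ∀ m → WalksMatch m
    walks-match base zero    = base
    walks-match base (suc m) = walks-match-suc m (walks-match base m)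

  -- The operators T and R

  shiftAssign : Assign → Assign
  shiftAssign σ = ((λ i → proj₁ σ (suc i)) , (λ i → proj₂ σ (suc i)))

  shiftAssignⁿ : ℕ → Assign → Assign
  shiftAssignⁿ zero    σ = σ
  shiftAssignⁿ (suc t) σ = shiftAssignⁿ t (shiftAssign σ)

  Tpow-shift : ∀ t P σ → Tpow t P σ ≡ P (shiftAssignⁿ t σ)
  Tpow-shift zero    P σ = ≡.refl
  Tpow-shift (suc t) P σ = Tpow-shift t P (shiftAssign σ)

  coef-shiftⁿ : ∀ t σ i → coef (shiftAssignⁿ t σ) i ≡ coef σ (2 * t + i)
  coef-shiftⁿ zero    σ i = ≡.refl
  coef-shiftⁿ (suc t) σ i =
    ≡.trans (coef-shiftⁿ t (shiftAssign σ) i) (≡.cong (λ z → coef σ (z + i)) (≡.sym (ℕ.*-suc 2 t)))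

  Tpow-Q : ∀ t n σ → Tpow t (QP n) σ ≋ continuant (λ i → coef σ (2 * t + i)) (suc n)
  Tpow-Q t n σ rewrite Tpow-shift t (QP n) σ =
    ≋-trans (Q≋continuant (shiftAssignⁿ t σ) n) (continuant-cong-≡ (coef-shiftⁿ t σ) (suc n))

  reflectAssign : ℕ → Assign → Assign
  reflectAssign j σ = ((λ i → proj₂ σ (suc j ∸ i)) , (λ i → proj₁ σ (suc j ∸ i)))

  coef-reflect : ∀ j σ i → i < 2 * j → coef (reflectAssign j σ) i ≡ coef σ (2 * j ∸ suc i)
  coef-reflect (suc j) σ zero _ =
    ≡.sym (≡.trans (≡.cong (λ z → coef σ (z ∸ 1)) (ℕ.*-suc 2 j)) (coef-odd σ j))
  coef-reflect (suc j) σ (suc zero) _ =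
    ≡.sym (≡.trans (≡.cong (λ z → coef σ (z ∸ 2)) (ℕ.*-suc 2 j)) (coef-even σ j))
  coef-reflect (suc j) σ (suc (suc i)) i+2<2j+2 =
    ≡.trans (coef-reflect j σ i (ℕ.≤-pred (ℕ.≤-pred (ℕ.≤-trans i+2<2j+2 (ℕ.≤-reflexive (ℕ.*-suc 2 j))))))
            (≡.cong (λ z → coef σ (z ∸ suc (suc (suc i)))) (≡.sym (ℕ.*-suc 2 j)))

  private
    ∸-reverse : ∀ M n i → i < n → n ≤ M → M ∸ suc (n ∸ suc i) ≡ M ∸ n + i
    ∸-reverse M n i i<n n≤M with ℕ.m≤n⇒∃[o]m+o≡n i<n | ℕ.m≤n⇒∃[o]m+o≡n n≤M
    ... | d , ≡.refl | e , ≡.refl = begin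
      suc i + d + e ∸ suc (suc i + d ∸ suc i) ≡⟨ ≡.cong (λ z → suc i + d + e ∸ suc z) (ℕ.m+n∸m≡n (suc i) d) ⟩
      suc i + d + e ∸ suc d                   ≡⟨ ≡.cong (_∸ suc d) (rearrange i d e) ⟩
      suc d + (i + e) ∸ suc d                 ≡⟨ ℕ.m+n∸m≡n (suc d) (i + e) ⟩
      i + e                                   ≡⟨ ℕ.+-comm i e ⟩
      e + i                                   ≡⟨ ≡.cong (_+ i) (ℕ.m+n∸m≡n (suc i + d) e) ⟨
      suc i + d + e ∸ (suc i + d) + i         ∎
      where
      open ≡.≡-Reasoning
      rearrange : ∀ i d e → suc i + d + e ≡ suc d + (i + e)
      rearrange = solve-∀

  Rop-Q : ∀ j n σ → n < 2 * j → Rop j (QP n) σ ≋ continuant (λ i → coef σ (2 * j ∸ n + i)) (suc n)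
  Rop-Q j n σ n<2j = begin
    Q (reflectAssign j σ) n
      ≈⟨ Q≋continuant (reflectAssign j σ) n ⟩
    continuant (coef (reflectAssign j σ)) (suc n)
      ≈⟨ continuant-cong n (λ i i<n → reflexive (coef-reflect j σ i (ℕ.<-trans i<n n<2j))) ⟩
    continuant (λ i → coef σ (2 * j ∸ suc i)) (suc n)
      ≈⟨ continuant-reverse _ n ⟩
    continuant (λ i → coef σ (2 * j ∸ suc (n ∸ suc i))) (suc n)
      ≈⟨ continuant-cong n (λ i i<n → reflexive (≡.cong (coef σ) (∸-reverse (2 * j) n i i<n (ℕ.<⇒≤ n<2j)))) ⟩
    continuant (λ i → coef σ (2 * j ∸ n + i)) (suc n) ∎
    where open ≋-Reasoning

  Tpow-Rop-Q : ∀ t j n σ → n < 2 * j →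
    Tpow t (Rop j (QP n)) σ ≋ continuant (λ i → coef σ (2 * t + (2 * j ∸ n + i))) (suc n)
  Tpow-Rop-Q t j n σ n<2j rewrite Tpow-shift t (Rop j (QP n)) σ =
    ≋-trans (Rop-Q j n (shiftAssignⁿ t σ) n<2j) (continuant-cong-≡ (λ i → coef-shiftⁿ t σ _) (suc n))

  Tpow-Rop-Q-tail : ∀ σ k j → j < k →
    Tpow j (Rop (k ∸ suc j + 1) (QP (2 * k + 1 ∸ 2 * suc j))) σ
      ≋ continuant (λ i → coef σ (suc (2 * j) + i)) (suc (2 * k) ∸ suc (2 * j))
  Tpow-Rop-Q-tail σ k j j<k with ℕ.m≤n⇒∃[o]m+o≡n j<k
  ... | w , ≡.refl = begin
    Tpow j (Rop (suc j + w ∸ suc j + 1) (QP (2 * (suc j + w) + 1 ∸ 2 * suc j))) σ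
      ≡⟨ ≡.cong₂ (λ a n → Tpow j (Rop a (QP n)) σ) reflection-size length ⟩
    Tpow j (Rop (suc w) (QP (suc (2 * w)))) σ
      ≈⟨ Tpow-Rop-Q j (suc w) (suc (2 * w)) σ (ℕ.≤-reflexive (≡.sym (ℕ.*-suc 2 w))) ⟩
    continuant (λ i → coef σ (2 * j + (2 * suc w ∸ suc (2 * w) + i))) (suc (suc (2 * w)))
      ≈⟨ continuant-cong-≡ (λ i → ≡.cong (coef σ) (first-index i)) (suc (suc (2 * w))) ⟩
    continuant (λ i → coef σ (suc (2 * j) + i)) (suc (suc (2 * w)))
      ≡⟨ ≡.cong (continuant _) (≡.sym (ℕ.m+n∸m≡n (2 * j) (suc (suc (2 * w))))) ⟩
    continuant (λ i → coef σ (suc (2 * j) + i)) (2 * j + suc (suc (2 * w)) ∸ 2 * j)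
      ≡⟨ ≡.cong (λ z → continuant (λ i → coef σ (suc (2 * j) + i)) (z ∸ 2 * j)) (double-split j w) ⟨
    continuant (λ i → coef σ (suc (2 * j) + i)) (2 * (suc j + w) ∸ 2 * j) ∎
    where
    open ≋-Reasoning
    reflection-size : suc j + w ∸ suc j + 1 ≡ suc w
    reflection-size = ≡.trans (≡.cong (_+ 1) (ℕ.m+n∸m≡n (suc j) w)) (ℕ.+-comm w 1)
    length : 2 * (suc j + w) + 1 ∸ 2 * suc j ≡ suc (2 * w)
    length = ≡.trans (≡.cong (_∸ 2 * suc j) (eq j w)) (ℕ.m+n∸m≡n (2 * suc j) (suc (2 * w)))
      where eq : ∀ j w → 2 * (suc j + w) + 1 ≡ 2 * suc j + suc (2 * w)
            eq = solve-∀
    first-index : ∀ i → 2 * j + (2 * suc w ∸ suc (2 * w) + i) ≡ suc (2 * j) + i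
    first-index i = ≡.trans (≡.cong (λ z → 2 * j + (z ∸ suc (2 * w) + i)) (ℕ.*-suc 2 w))
                      (≡.trans (≡.cong (λ z → 2 * j + (z + i)) (ℕ.m+n∸n≡m 1 (2 * w))) (ℕ.+-suc (2 * j) i))
    double-split : ∀ j w → 2 * (suc j + w) ≡ 2 * j + suc (suc (2 * w))
    double-split = solve-∀

  Tpow-Q-tail : ∀ σ k j → j < k →
    Tpow (suc j) (QP (2 * k ∸ 2 * suc j)) σ
      ≋ continuant (λ i → coef σ (suc (suc (2 * j)) + i)) (suc (2 * k) ∸ suc (suc (2 * j)))
  Tpow-Q-tail σ k j j<k with ℕ.m≤n⇒∃[o]m+o≡n j<k
  ... | w , ≡.refl = begin
    Tpow (suc j) (QP (2 * (suc j + w) ∸ 2 * suc j)) σ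
      ≈⟨ Tpow-Q (suc j) (2 * (suc j + w) ∸ 2 * suc j) σ ⟩
    continuant (λ i → coef σ (2 * suc j + i)) (suc (2 * (suc j + w) ∸ 2 * suc j))
      ≈⟨ continuant-cong-≡ (λ i → ≡.cong (λ z → coef σ (z + i)) (ℕ.*-suc 2 j)) (suc (2 * (suc j + w) ∸ 2 * suc j)) ⟩
    continuant (λ i → coef σ (suc (suc (2 * j)) + i)) (suc (2 * (suc j + w) ∸ 2 * suc j))
      ≡⟨ ≡.cong (continuant _) (≡.trans (≡.cong suc lower) (≡.sym upper)) ⟩
    continuant (λ i → coef σ (suc (suc (2 * j)) + i)) (2 * (suc j + w) ∸ suc (2 * j)) ∎
    where
    open ≋-Reasoning
    lower : 2 * (suc j + w) ∸ 2 * suc j ≡ 2 * w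
    lower = ≡.trans (≡.cong (_∸ 2 * suc j) (eq j w)) (ℕ.m+n∸m≡n (2 * suc j) (2 * w))
      where eq : ∀ j w → 2 * (suc j + w) ≡ 2 * suc j + 2 * w
            eq = solve-∀
    upper : 2 * (suc j + w) ∸ suc (2 * j) ≡ suc (2 * w)
    upper = ≡.trans (≡.cong (_∸ suc (2 * j)) (eq j w)) (ℕ.m+n∸m≡n (suc (2 * j)) (suc (2 * w)))
      where eq : ∀ j w → 2 * (suc j + w) ≡ suc (2 * j) + suc (2 * w)
            eq = solve-∀

  xS-⊛-⊛ : ∀ {P P′ S S′} → P ≋ P′ → S ≋ S′ → ((xS ⊛ P) ⊛ S) ≋ mulX (P′ ⊛ S′)
  xS-⊛-⊛ {P} {S′ = S′} p q =
    ≋-trans (⊛-cong (xS-⊛ P) q) (≋-trans (mulX-⊛ P S′) (mulX-cong (⊛-cong p (≋-refl {S′}))))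

  Q-even-continuant : ∀ σ j → Q σ (2 * suc j ∸ 2) ≋ continuant (coef σ) (suc (2 * j))
  Q-even-continuant σ j = ≋-trans (Q≋continuant σ (2 * suc j ∸ 2))
    (≡⇒≋ (≡.cong (λ z → continuant (coef σ) (suc (z ∸ 2))) (ℕ.*-suc 2 j)))

  Q-odd-continuant : ∀ σ j → Q σ (2 * suc j ∸ 1) ≋ continuant (coef σ) (suc (suc (2 * j)))
  Q-odd-continuant σ j = ≋-trans (Q≋continuant σ (2 * suc j ∸ 1))
    (≡⇒≋ (≡.cong (λ z → continuant (coef σ) (suc (z ∸ 1))) (ℕ.*-suc 2 j)))

  -- r = j + 1 and s = s₀ + 1.
  module Cases (A V : ℕ → Carrier) (k j s₀ : ℕ) (j<k : j < k) (s₀<k : s₀ < k) where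

    signPow-r+s+1 : signPow (suc j + suc s₀ + 1) ≈ signPow (suc s₀) *ᵣ signPow j
    signPow-r+s+1 = trans (reflexive (≡.cong signPow (eq j s₀))) (signPow-+ (suc s₀) j)
      where eq : ∀ j s₀ → suc j + suc s₀ + 1 ≡ suc (suc (suc s₀ + j))
            eq = solve-∀

    off-diagonal : ∀ a b {x y} → x ≈ y →
      a *ᵣ (0# +ᵣ (b *ᵣ signPow (suc s₀)) *ᵣ (signPow j *ᵣ x)) ≈ (signPow (suc j + suc s₀ + 1) *ᵣ (a *ᵣ b)) *ᵣ y
    off-diagonal a b {x} x≈y = trans
      (solve 5 (λ a b κ g x → a :* (con (+ 0) :+ (b :* κ) :* (g :* x)) := ((κ :* g) :* (a :* b)) :* x)
             refl a b (signPow (suc s₀)) (signPow j) x)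
      (*-cong (*-congʳ (sym signPow-r+s+1)) x≈y)

    module OddLength where
      open Matching A V k (2 * s₀) (ℕ.*-monoʳ-< 2 s₀<k) (suc s₀) isEven isEven-suc public

      F : Series
      F = oddLenSeries σ k (suc j) (suc s₀)

      walks-at-start : WalksMatch 0
      walks-at-start = (λ j′ _ → fromV j′) , (λ j′ _ → fromA j′)
        where
        fromV : ∀ j′ → walkV j′ 0 ≈ gfUp 0 (suc j′)
        fromV j′ rewrite ≡ᵇ-double j′ s₀ | coef-even σ j′ = sym (gfUp-zero (suc j′))
        fromA : ∀ j′ → walkA j′ 0 ≈ 0#
        fromA j′ rewrite ≡ᵇ-false (λ eq → ℕ.even≢odd s₀ j′ (≡.sym eq)) = refl

      F≋walkV : F ≋ walkV j
      F≋walkV = pointwise λ m → trans (select m) (sym (proj₁ (walks-match walks-at-start m) j j<k))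
        where
        select : ∀ m → F m ≈ only (isEven m) (gfUp m (suc j))
        select m with isEven m
        ... | true  = GF≈gfUp m j j<k
        ... | false = refl

      expanded : Series → Series → Series
      expanded S G m = V (suc j) *ᵣ (S m +ᵣ (V (suc s₀) *ᵣ signPow (suc s₀)) *ᵣ (signPow j *ᵣ mulX G m))

      F⊛Q : ∀ m → (F ⊛ Q σ (2 * k)) m ≈ expanded (source (2 * j)) (green (suc (2 * j))) m
      F⊛Q m = trans (at (⊛-cong F≋walkV (Q≋continuant σ (2 * k))) m)
        (trans (proj₁ (walk-⊛-det m) j j<k)
          (*-cong (reflexive (coef-even σ j))
            (+-congˡ (*-cong (*-cong (reflexive (coef-even σ s₀))
                                     (reflexive (≡.cong (λ z → signPow (suc z)) (⌊2n/2⌋≡n s₀))))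
                             (at (mulX-scale (signPow j) _) m)))))

      case-< : suc j < suc s₀ → ∀ m → (F ⊛ Q σ (2 * k)) m ≈
        scale (signPow (suc j + suc s₀ + 1) · (V (suc j) · V (suc s₀)))
          ((xS ⊛ Q σ (2 * suc j ∸ 2)) ⊛ Tpow (suc s₀ ∸ 1) (Rop (k ∸ suc s₀ + 1) (QP (2 * k + 1 ∸ 2 * suc s₀))) σ) m
      case-< (s≤s j<s₀) m = begin
        (F ⊛ Q σ (2 * k)) m
          ≈⟨ F⊛Q m ⟩
        expanded (source (2 * j)) (green (suc (2 * j))) m
          ≡⟨ ≡.cong₂ (λ S G → expanded S G m) (source-≢ (ℕ.<⇒≢ 2j<2s₀)) (green-≤ (s≤s (ℕ.<⇒≤ 2j<2s₀))) ⟩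
        expanded 0ₛ (continuant (coef σ) (suc (2 * j)) ⊛ tailContinuant (suc (2 * s₀))) m
          ≈⟨ off-diagonal _ _ (at (≋-sym (xS-⊛-⊛ (Q-even-continuant σ j) (Tpow-Rop-Q-tail σ k s₀ s₀<k))) m) ⟩
        _ ∎
        where
        open ≈-Reasoning
        2j<2s₀ : 2 * j < 2 * s₀
        2j<2s₀ = ℕ.*-monoʳ-< 2 j<s₀

      case-> : suc j > suc s₀ → ∀ m → (F ⊛ Q σ (2 * k)) m ≈
        scale (signPow (suc j + suc s₀ + 1) · (V (suc j) · V (suc s₀)))
          ((xS ⊛ Q σ (2 * suc s₀ ∸ 2)) ⊛ Tpow (suc j ∸ 1) (Rop (k ∸ suc j + 1) (QP (2 * k + 1 ∸ 2 * suc j))) σ) m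
      case-> (s≤s s₀<j) m = begin
        (F ⊛ Q σ (2 * k)) m
          ≈⟨ F⊛Q m ⟩
        expanded (source (2 * j)) (green (suc (2 * j))) m
          ≡⟨ ≡.cong₂ (λ S G → expanded S G m) (source-≢ (ℕ.>⇒≢ 2s₀<2j)) (green-≥ (s≤s (ℕ.<⇒≤ 2s₀<2j))) ⟩
        expanded 0ₛ (continuant (coef σ) (suc (2 * s₀)) ⊛ tailContinuant (suc (2 * j))) m
          ≈⟨ off-diagonal _ _ (at (≋-sym (xS-⊛-⊛ (Q-even-continuant σ s₀) (Tpow-Rop-Q-tail σ k j j<k))) m) ⟩
        _ ∎
        where
        open ≈-Reasoning
        2s₀<2j : 2 * s₀ < 2 * j
        2s₀<2j = ℕ.*-monoʳ-< 2 s₀<j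

      -- Here the single-element sequence (r) contributes V_r, and κ · (−1)ʲ = −1 turns the sign.
      case-≡ : j ≡ s₀ → ∀ m → (F ⊛ Q σ (2 * k)) m ≈
        ((scale (V (suc j)) (Q σ (2 * k))) ⊖ scale (V (suc j) · V (suc j))
          ((xS ⊛ Q σ (2 * suc j ∸ 2)) ⊛ Tpow (suc j ∸ 1) (Rop (k ∸ suc j + 1) (QP (2 * k + 1 ∸ 2 * suc j))) σ)) m
      case-≡ j≡s₀ m = begin
        (F ⊛ Q σ (2 * k)) m
          ≈⟨ F⊛Q m ⟩
        expanded (source (2 * j)) (green (suc (2 * j))) m
          ≡⟨ ≡.cong₂ (λ S G → expanded S G m) (≡.trans (≡.cong source 2j≡2s₀) source-q)
                                                (green-≤ (s≤s (ℕ.≤-reflexive 2j≡2s₀))) ⟩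
        V (suc j) *ᵣ (det m +ᵣ (V (suc s₀) *ᵣ signPow (suc s₀)) *ᵣ (signPow j *ᵣ y))
          ≈⟨ *-congˡ (+-congˡ (*-congʳ (*-congʳ (reflexive (≡.cong (λ z → V (suc z)) (≡.sym j≡s₀)))))) ⟩
        V (suc j) *ᵣ (det m +ᵣ (V (suc j) *ᵣ signPow (suc s₀)) *ᵣ (signPow j *ᵣ y))
          ≈⟨ solve 5 (λ a κ g d y → a :* (d :+ (a :* κ) :* (g :* y)) := a :* d :+ (a :* a) :* ((κ :* g) :* y))
                   refl (V (suc j)) (signPow (suc s₀)) (signPow j) (det m) y ⟩
        V (suc j) *ᵣ det m +ᵣ (V (suc j) *ᵣ V (suc j)) *ᵣ ((signPow (suc s₀) *ᵣ signPow j) *ᵣ y)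
          ≈⟨ +-cong (*-congˡ (sym (at (Q≋continuant σ (2 * k)) m))) (*-congˡ (*-congʳ κ·signPow≈-1)) ⟩
        V (suc j) *ᵣ Q σ (2 * k) m +ᵣ (V (suc j) *ᵣ V (suc j)) *ᵣ ((- 1#) *ᵣ y)
          ≈⟨ +-congˡ (trans (solve 3 (λ a y o → a :* ((:- o) :* y) := :- (a :* (o :* y))) refl _ y 1#)
                            (-‿cong (*-congˡ (*-identityˡ y)))) ⟩
        V (suc j) *ᵣ Q σ (2 * k) m - (V (suc j) *ᵣ V (suc j)) *ᵣ y
          ≈⟨ +-congˡ (-‿cong (*-congˡ (sym (at product m)))) ⟩
        _ ∎
        where
        open ≈-Reasoning
        2j≡2s₀ : 2 * j ≡ 2 * s₀
        2j≡2s₀ = ≡.cong (2 *_) j≡s₀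
        y : Carrier
        y = mulX (continuant (coef σ) (suc (2 * j)) ⊛ tailContinuant (suc (2 * s₀))) m
        κ·signPow≈-1 : signPow (suc s₀) *ᵣ signPow j ≈ - 1#
        κ·signPow≈-1 = ≡.subst (λ z → signPow (suc z) *ᵣ signPow j ≈ - 1#) j≡s₀ (signPow-suc-* j)
        product : ((xS ⊛ Q σ (2 * suc j ∸ 2)) ⊛ Tpow j (Rop (k ∸ suc j + 1) (QP (2 * k + 1 ∸ 2 * suc j))) σ)
                  ≋ mulX (continuant (coef σ) (suc (2 * j)) ⊛ tailContinuant (suc (2 * s₀)))
        product = xS-⊛-⊛ (Q-even-continuant σ j)
          (≋-trans (Tpow-Rop-Q-tail σ k j j<k) (≡⇒≋ (≡.cong (λ z → tailContinuant (suc (2 * z))) j≡s₀)))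

    module EvenLength where
      open Matching A V k (suc (2 * s₀)) (ℕ.≤-trans (ℕ.≤-reflexive (≡.sym (ℕ.*-suc 2 s₀))) (ℕ.*-monoʳ-≤ 2 s₀<k))
                    (suc s₀) (λ m → not (isEven m)) (λ m → ≡.cong not (isEven-suc m)) public

      F : Series
      F = evenLenSeries σ k (suc j) (suc s₀)

      walks-at-start : WalksMatch 0
      walks-at-start = (λ j′ _ → fromV j′) , (λ j′ _ → fromA j′)
        where
        fromV : ∀ j′ → walkV j′ 0 ≈ 0#
        fromV j′ rewrite ≡ᵇ-false (ℕ.even≢odd j′ s₀) = refl
        fromA : ∀ j′ → walkA j′ 0 ≈ gfDown 0 (suc j′)
        fromA j′ rewrite ≡ᵇ-double j′ s₀ | coef-odd σ j′ = sym (gfDown-zero (suc j′))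

      F≋walkV : F ≋ walkV j
      F≋walkV = pointwise λ m → trans (select m) (sym (proj₁ (walks-match walks-at-start m) j j<k))
        where
        select : ∀ m → F m ≈ only (not (isEven m)) (gfUp m (suc j))
        select m with isEven m
        ... | true  = refl
        ... | false = GF≈gfUp m j j<k

      expanded : Series → Series
      expanded G m = V (suc j) *ᵣ (0# +ᵣ (A (suc s₀) *ᵣ signPow (suc s₀)) *ᵣ (signPow j *ᵣ mulX G m))

      F⊛Q : ∀ m → (F ⊛ Q σ (2 * k)) m ≈ expanded (green (suc (2 * j))) m
      F⊛Q m = trans (at (⊛-cong F≋walkV (Q≋continuant σ (2 * k))) m)
        (trans (proj₁ (walk-⊛-det m) j j<k)
          (*-cong (reflexive (coef-even σ j))
            (+-cong (reflexive (≡.cong (λ S → S m) (source-≢ (ℕ.even≢odd j s₀))))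
                    (*-cong (*-cong (reflexive (coef-odd σ s₀))
                                    (reflexive (≡.cong (λ z → signPow (suc z)) (⌊1+2n/2⌋≡n s₀))))
                            (at (mulX-scale (signPow j) _) m)))))

      case-≤ : suc j ≤ suc s₀ → ∀ m → (F ⊛ Q σ (2 * k)) m ≈
        scale (signPow (suc j + suc s₀ + 1) · (V (suc j) · A (suc s₀)))
          ((xS ⊛ Q σ (2 * suc j ∸ 2)) ⊛ Tpow (suc s₀) (QP (2 * k ∸ 2 * suc s₀)) σ) m
      case-≤ (s≤s j≤s₀) m = begin
        (F ⊛ Q σ (2 * k)) m
          ≈⟨ F⊛Q m ⟩
        expanded (green (suc (2 * j))) m
          ≡⟨ ≡.cong (λ G → expanded G m) (green-≤ (ℕ.m≤n⇒m≤1+n (s≤s (ℕ.*-monoʳ-≤ 2 j≤s₀)))) ⟩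
        expanded (continuant (coef σ) (suc (2 * j)) ⊛ tailContinuant (suc (suc (2 * s₀)))) m
          ≈⟨ off-diagonal _ _ (at (≋-sym (xS-⊛-⊛ (Q-even-continuant σ j) (Tpow-Q-tail σ k s₀ s₀<k))) m) ⟩
        _ ∎
        where open ≈-Reasoning

      case-> : suc j > suc s₀ → ∀ m → (F ⊛ Q σ (2 * k)) m ≈
        scale (signPow (suc j + suc s₀ + 1) · (V (suc j) · A (suc s₀)))
          ((xS ⊛ Q σ (2 * suc s₀ ∸ 1)) ⊛ Tpow (suc j ∸ 1) (Rop (k ∸ suc j + 1) (QP (2 * k + 1 ∸ 2 * suc j))) σ) m
      case-> (s≤s s₀<j) m = begin
        (F ⊛ Q σ (2 * k)) m
          ≈⟨ F⊛Q m ⟩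
        expanded (green (suc (2 * j))) m
          ≡⟨ ≡.cong (λ G → expanded G m) (green-≥ (s≤s (ℕ.*-monoʳ-< 2 s₀<j))) ⟩
        expanded (continuant (coef σ) (suc (suc (2 * s₀))) ⊛ tailContinuant (suc (2 * j))) m
          ≈⟨ off-diagonal _ _ (at (≋-sym (xS-⊛-⊛ (Q-odd-continuant σ s₀) (Tpow-Rop-Q-tail σ k j j<k))) m) ⟩
        _ ∎
        where open ≈-Reasoning

theorem28 : ∀ {c ℓ} (R : CommutativeRing c ℓ) →
    let open WithRing R
    in (A V : ℕ → Car) (k r s : ℕ) → 1 ≤ r → r ≤ k → 1 ≤ s → s ≤ k →
    let σ = (A , V)
        D = Q σ (2 * k)
        F₁ = oddLenSeries σ k r s
        F₂ = evenLenSeries σ k r s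
    in (r < s → ∀ m → (F₁ ⊛ D) m ≈R
          scale (signPow (r + s + 1) · (V r · V s))
            ((xS ⊛ Q σ (2 * r ∸ 2)) ⊛ Tpow (s ∸ 1) (Rop (k ∸ s + 1) (QP (2 * k + 1 ∸ 2 * s))) σ) m)
     × (r ≡ s → ∀ m → (F₁ ⊛ D) m ≈R
          ((scale (V r) D) ⊖ scale (V r · V r)
            ((xS ⊛ Q σ (2 * r ∸ 2)) ⊛ Tpow (r ∸ 1) (Rop (k ∸ r + 1) (QP (2 * k + 1 ∸ 2 * r))) σ)) m)
     × (r > s → ∀ m → (F₁ ⊛ D) m ≈R
          scale (signPow (r + s + 1) · (V r · V s))
            ((xS ⊛ Q σ (2 * s ∸ 2)) ⊛ Tpow (r ∸ 1) (Rop (k ∸ r + 1) (QP (2 * k + 1 ∸ 2 * r))) σ) m)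
     × (r ≤ s → ∀ m → (F₂ ⊛ D) m ≈R
          scale (signPow (r + s + 1) · (V r · A s))
            ((xS ⊛ Q σ (2 * r ∸ 2)) ⊛ Tpow s (QP (2 * k ∸ 2 * s)) σ) m)
     × (r > s → ∀ m → (F₂ ⊛ D) m ≈R
          scale (signPow (r + s + 1) · (V r · A s))
            ((xS ⊛ Q σ (2 * s ∸ 1)) ⊛ Tpow (r ∸ 1) (Rop (k ∸ r + 1) (QP (2 * k + 1 ∸ 2 * r))) σ) m)
theorem28 R A V k zero    s       () _   _  _
theorem28 R A V k (suc j) zero    _  _   () _
theorem28 R A V k (suc j) (suc s₀) _ j<k _  s₀<k =
    OddLength.case-<
  , (λ { ≡.refl → Cases.OddLength.case-≡ R A V k j j j<k j<k ≡.refl })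
  , OddLength.case->
  , EvenLength.case-≤
  , EvenLength.case->
  where open Cases R A V k j s₀ j<k s₀<k
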